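{- For every integer $m\geq 1$, \begin{align*} \sum_{n\geq 1}M(m,n)q^n={}&\frac{q^m}{(q^2;q)_{m-1}}+\frac{q^{3m+4}}{(q^2;q)_{m-1}}+\sum_{k\geq 1}\frac{q^{k(k+m)+2k+m}}{(q;q)_k(q^2;q)_{k+m-2}}+\sum_{k\geq 2}\frac{q^{k(k+m)+3k+2m}}{(q^2;q)_{k-1}(q^2;q)_{k+m-2}}\\ &+\sum_{k\geq 1}\frac{q^{k(k+m)+3k+2m+1}}{(q;q)_k(q^2;q)_{k+m-1}}+\sum_{k\geq 1}\frac{q^{k(k+m)+4k+3m}}{(q^2;q)_{k-1}(q^2;q)_{k+m-2}}+\sum_{k\geq 1}\frac{q^{k(k+m)+5k+4m}}{(q^2;q)_{k-1}(q^2;q)_{k+m-1}}. \end{align*}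
   Context: For a partition $\lambda$, let $\omega(\lambda)$ be the number of parts equal to $1$ and $\mu(\lambda)$ the number of parts larger than $\omega(\lambda)$; the crank of $\lambda$ is its largest part if $\omega(\lambda)=0$ and $\mu(\lambda)-\omega(\lambda)$ otherwise. For $n>1$, $M(m,n)$ is the number of partitions of $n$ with crank $m$; for $n=1$: $M(0,1)=-1$, $M(\pm1,1)=1$, $M(m,1)=0$ otherwise. $(a;q)_j=\prod_{i=0}^{j-1}(1-aq^i)$, $(a;q)_0=1$. The identity is of formal power series in $q$. -}

module Defs where

open import Data.Nat as ℕ using (ℕ; zero; suc; _∸_; _⊔_; _≡ᵇ_; _<ᵇ_; _%_)
open import Data.Integer as ℤ using (ℤ; +_; 0ℤ; 1ℤ; -1ℤ)
open import Data.Bool using (Bool; true; false; if_then_else_)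
open import Data.List using (List; []; _∷_; [_]; map; concatMap; replicate; _++_; foldr; length; filter; upTo)
open import Relation.Binary.PropositionalEquality using (_≡_)
open import Relation.Nullary.Decidable using (does)

-- partsBounded p n : all partitions of n into parts ≤ p, each listed
-- as a non-increasing list of positive parts (largest part first).
-- Built by choosing the multiplicity c of the part p.
partsBounded : ℕ → ℕ → List (List ℕ)
partsBounded zero    zero    = [ [] ]
partsBounded zero    (suc _) = []
partsBounded (suc p) n =
  concatMap (λ c → if (n ℕ.<ᵇ c ℕ.* suc p) then []
                   else map (replicate c (suc p) ++_) (partsBounded p (n ∸ c ℕ.* suc p)))
            (upTo (suc n))

partitions : ℕ → List (List ℕ)
partitions n = partsBounded n n

countIf : {A : Set} → (A → Bool) → List A → ℕ
countIf P []       = 0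
countIf P (x ∷ xs) = (if P x then 1 else 0) ℕ.+ countIf P xs

ω : List ℕ → ℕ
ω λ′ = countIf (λ a → a ≡ᵇ 1) λ′

μ : List ℕ → ℕ
μ λ′ = countIf (λ a → ω λ′ <ᵇ a) λ′

largestPart : List ℕ → ℕ
largestPart = foldr _⊔_ 0

crank : List ℕ → ℤ
crank λ′ with ω λ′
... | zero  = + largestPart λ′
... | suc w = + μ λ′ ℤ.- + suc w

-- M(m,n), with the special convention for n = 1
M : ℤ → ℕ → ℤ
M m 1 = if does (m ℤ.≟ 0ℤ) then -1ℤ
        else if does (m ℤ.≟ 1ℤ) then 1ℤ
        else if does (m ℤ.≟ -1ℤ) then 1ℤ
        else 0ℤ
M m n = + countIf (λ λ′ → does (crank λ′ ℤ.≟ m)) (partitions n)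

PS : Set
PS = ℕ → ℤ

_≋_ : PS → PS → Set
f ≋ g = ∀ N → f N ≡ g N
infix 4 _≋_

Σ< : ℕ → (ℕ → ℤ) → ℤ
Σ< zero    f = 0ℤ
Σ< (suc n) f = Σ< n f ℤ.+ f n

one : PS
one zero    = 1ℤ
one (suc _) = 0ℤ

mono : ℕ → PS
mono e N = if e ≡ᵇ N then 1ℤ else 0ℤ

_⊕_ : PS → PS → PS
(f ⊕ g) N = f N ℤ.+ g N
infixl 6 _⊕_

_⊛_ : PS → PS → PS
(f ⊛ g) N = Σ< (suc N) (λ i → f i ℤ.* g (N ∸ i))
infixl 7 _⊛_

-- geomInv d = 1/(1 - q^(d+1)) = Σ_j q^((d+1) j)
geomInv : ℕ → PS
geomInv d N = if (N % suc d) ≡ᵇ 0 then 1ℤ else 0ℤ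

-- invPoch s j = 1/(q^s;q)_j = Π_{i<j} 1/(1 - q^(s+i)),  for s ≥ 1
-- (only used with s = 1, 2)
invPoch : ℕ → ℕ → PS
invPoch s zero    = one
invPoch s (suc j) = invPoch s j ⊛ geomInv (s ℕ.+ j ∸ 1)

-- Σ_{k ≥ a} F k, where F k has q-adic order ≥ k (so the sum is locally
-- finite: the coefficient of q^N only receives contributions from
-- k ≤ N ≤ a + N).
sumFrom : ℕ → (ℕ → PS) → PS
sumFrom a F N = Σ< (suc N) (λ j → F (a ℕ.+ j) N)

crankGF : ℕ → PS
crankGF m zero    = 0ℤ
crankGF m (suc n) = M (+ m) (suc n)

rhs : ℕ → PS
rhs m =
    mono m ⊛ invPoch 2 (m ∸ 1)
  ⊕ mono (3 ℕ.* m ℕ.+ 4) ⊛ invPoch 2 (m ∸ 1)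
  ⊕ sumFrom 1 (λ k → mono (k ℕ.* (k ℕ.+ m) ℕ.+ 2 ℕ.* k ℕ.+ m)
                       ⊛ invPoch 1 k ⊛ invPoch 2 (k ℕ.+ m ∸ 2))
  ⊕ sumFrom 2 (λ k → mono (k ℕ.* (k ℕ.+ m) ℕ.+ 3 ℕ.* k ℕ.+ 2 ℕ.* m)
                       ⊛ invPoch 2 (k ∸ 1) ⊛ invPoch 2 (k ℕ.+ m ∸ 2))
  ⊕ sumFrom 1 (λ k → mono (k ℕ.* (k ℕ.+ m) ℕ.+ 3 ℕ.* k ℕ.+ 2 ℕ.* m ℕ.+ 1)
                       ⊛ invPoch 1 k ⊛ invPoch 2 (k ℕ.+ m ∸ 1))
  ⊕ sumFrom 1 (λ k → mono (k ℕ.* (k ℕ.+ m) ℕ.+ 4 ℕ.* k ℕ.+ 3 ℕ.* m)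
                       ⊛ invPoch 2 (k ∸ 1) ⊛ invPoch 2 (k ℕ.+ m ∸ 2))
  ⊕ sumFrom 1 (λ k → mono (k ℕ.* (k ℕ.+ m) ℕ.+ 5 ℕ.* k ℕ.+ 4 ℕ.* m)
                       ⊛ invPoch 2 (k ∸ 1) ⊛ invPoch 2 (k ℕ.+ m ∸ 1))

-- A partition of n ≥ 2 with crank m ≥ 1 either has no ones and largest part m, or it has w ≥ 1
-- ones and exactly m + w parts larger than w.  The first kind is counted by q^m / (q²;q)_(m-1);
-- in the second kind the parts in [2, w] contribute q^w / (q²;q)_(w-1), and removing w from each
-- of the m + w large parts leaves a partition into exactly m + w parts, counted by
-- q^(w(m+w)) · q^(m+w) / (q;q)_(m+w).  So the crank generating function is
--   q^m / (q²;q)_(m-1) + Σ_(w ≥ 1) q^(w(m+w)+m+2w) / ((q²;q)_(w-1) (q;q)_(m+w)).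
-- Writing 1 / (q;q)_(m+w) = 1/(1-q) · 1/(q²;q)_(m+w-2) · 1/(1-q^(m+w)) and expanding with
-- 1/(1-y) = 1 + y/(1-y), once for y = q and three times for y = q^(m+w), splits the w-th term
-- into the k = w terms of the last five sums; the k = 1 term of the fourth sum is the second summand.

module Submission where

open import Defs

open import Algebra.Bundles using (CommutativeMonoid)
open import Data.Bool using (Bool; true; false; if_then_else_; _∧_)
open import Data.Bool.Properties using (∧-zeroʳ; ∧-identityʳ)
open import Data.Integer as ℤ using (ℤ; +_; 0ℤ; 1ℤ)
import Data.Integer.Properties as ℤₚ
open import Data.Integer.Tactic.RingSolver using () renaming (solve-∀ to ℤ-solve-∀)
open import Data.List using (List; []; _∷_; _++_; map; concatMap; applyUpTo; upTo; replicate)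
open import Data.List.Relation.Unary.All as All using (All; []; _∷_)
import Data.List.Relation.Unary.All.Properties as Allₚ
open import Data.Nat as ℕ using (ℕ; zero; suc; _∸_; _⊔_; _≤_; _<_; z≤n; s≤s; _≡ᵇ_; _≤ᵇ_)
open import Data.Nat.DivMod using (m≤n⇒[n∸m]%m≡n%m; m<n⇒m%n≡m)
open import Data.Nat.Induction using (<-rec)
import Data.Nat.Properties as ℕₚ
open import Data.Nat.Tactic.RingSolver using () renaming (solve-∀ to ℕ-solve-∀)
open import Data.Product using (_,_)
open import Data.Sum using (inj₁; inj₂)
open import Function using (id; _∘_; _⟨_⟩_; mk⇔)
open import Level using (0ℓ)
open import Relation.Binary.PropositionalEquality using (_≡_; _≢_; refl; sym; trans; cong; cong₂; subst; module ≡-Reasoning)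
open import Relation.Nullary using (Dec; yes; no; does)
open import Relation.Nullary.Decidable using (dec-true; dec-false; does-⇔)
open import Relation.Nullary.Negation using (contradiction)

open import Algebra.Properties.CommutativeSemigroup ℤₚ.+-commutativeSemigroup using () renaming (interchange to +-interchange)
open ≡-Reasoning

Σ<-cong : ∀ n {f g : ℕ → ℤ} → (∀ i → i < n → f i ≡ g i) → Σ< n f ≡ Σ< n g
Σ<-cong zero    f≗g = refl
Σ<-cong (suc n) f≗g = cong₂ ℤ._+_ (Σ<-cong n (λ i i<n → f≗g i (ℕₚ.m<n⇒m<1+n i<n))) (f≗g n ℕₚ.≤-refl)

Σ<-zero : ∀ n {f : ℕ → ℤ} → (∀ i → i < n → f i ≡ 0ℤ) → Σ< n f ≡ 0ℤ
Σ<-zero n {f} f≗0 = Σ<-cong n f≗0 ⟨ trans ⟩ zeros n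
  where
  zeros : ∀ n → Σ< n (λ _ → 0ℤ) ≡ 0ℤ
  zeros zero    = refl
  zeros (suc n) = cong (ℤ._+ 0ℤ) (zeros n)

Σ<-+ : ∀ n (f g : ℕ → ℤ) → Σ< n (λ i → f i ℤ.+ g i) ≡ Σ< n f ℤ.+ Σ< n g
Σ<-+ zero    f g = refl
Σ<-+ (suc n) f g = cong (ℤ._+ (f n ℤ.+ g n)) (Σ<-+ n f g) ⟨ trans ⟩ +-interchange (Σ< n f) (Σ< n g) (f n) (g n)

Σ<-*ˡ : ∀ n (a : ℤ) (f : ℕ → ℤ) → Σ< n (λ i → a ℤ.* f i) ≡ a ℤ.* Σ< n f
Σ<-*ˡ zero    a f = sym (ℤₚ.*-zeroʳ a)
Σ<-*ˡ (suc n) a f = cong (ℤ._+ a ℤ.* f n) (Σ<-*ˡ n a f) ⟨ trans ⟩ sym (ℤₚ.*-distribˡ-+ a (Σ< n f) (f n))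

Σ<-head : ∀ n (f : ℕ → ℤ) → Σ< (suc n) f ≡ f 0 ℤ.+ Σ< n (λ i → f (suc i))
Σ<-head zero    f = ℤₚ.+-identityˡ (f 0) ⟨ trans ⟩ sym (ℤₚ.+-identityʳ (f 0))
Σ<-head (suc n) f = cong (ℤ._+ f (suc n)) (Σ<-head n f) ⟨ trans ⟩ ℤₚ.+-assoc (f 0) _ _

Σ<-split : ∀ a b (f : ℕ → ℤ) → Σ< (a ℕ.+ b) f ≡ Σ< a f ℤ.+ Σ< b (λ i → f (a ℕ.+ i))
Σ<-split a zero    f = cong (λ n → Σ< n f) (ℕₚ.+-identityʳ a) ⟨ trans ⟩ sym (ℤₚ.+-identityʳ _)
Σ<-split a (suc b) f rewrite ℕₚ.+-suc a b =
  cong (ℤ._+ f (a ℕ.+ b)) (Σ<-split a b f) ⟨ trans ⟩ ℤₚ.+-assoc (Σ< a f) _ _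

Σ<-extend : ∀ {a b} (f : ℕ → ℤ) → a ≤ b → (∀ i → a ≤ i → f i ≡ 0ℤ) → Σ< b f ≡ Σ< a f
Σ<-extend {a} {b} f a≤b f≗0 = begin
  Σ< b f                                            ≡⟨ cong (λ n → Σ< n f) (ℕₚ.m+[n∸m]≡n a≤b) ⟨
  Σ< (a ℕ.+ (b ∸ a)) f                              ≡⟨ Σ<-split a (b ∸ a) f ⟩
  Σ< a f ℤ.+ Σ< (b ∸ a) (λ i → f (a ℕ.+ i))         ≡⟨ cong (λ x → Σ< a f ℤ.+ x) (Σ<-zero (b ∸ a) (λ i _ → f≗0 (a ℕ.+ i) (ℕₚ.m≤m+n a i))) ⟩
  Σ< a f ℤ.+ 0ℤ                                     ≡⟨ ℤₚ.+-identityʳ _ ⟩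
  Σ< a f                                            ∎

Σ<-swap : ∀ n k (F : ℕ → ℕ → ℤ) → Σ< n (λ i → Σ< k (F i)) ≡ Σ< k (λ j → Σ< n (λ i → F i j))
Σ<-swap zero    k F = sym (Σ<-zero k (λ _ _ → refl))
Σ<-swap (suc n) k F = cong (ℤ._+ Σ< k (F n)) (Σ<-swap n k F) ⟨ trans ⟩ sym (Σ<-+ k _ (F n))

Σ<-reverse : ∀ n (f : ℕ → ℤ) → Σ< n f ≡ Σ< n (λ i → f (n ∸ suc i))
Σ<-reverse zero    f = refl
Σ<-reverse (suc n) f = begin
  Σ< n f ℤ.+ f n                          ≡⟨ ℤₚ.+-comm (Σ< n f) (f n) ⟩
  f n ℤ.+ Σ< n f                          ≡⟨ cong (λ x → f n ℤ.+ x) (Σ<-reverse n f) ⟩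
  f n ℤ.+ Σ< n (λ i → f (n ∸ suc i))      ≡⟨ Σ<-head n (λ i → f (suc n ∸ suc i)) ⟨
  Σ< (suc n) (λ i → f (suc n ∸ suc i))    ∎

Σ<-single : ∀ n e (f : ℕ → ℤ) → e < n → (∀ i → i < n → i ≢ e → f i ≡ 0ℤ) → Σ< n f ≡ f e
Σ<-single (suc n) e f e<1+n f≗0 with ℕₚ.m≤n⇒m<n∨m≡n (ℕₚ.≤-pred e<1+n)
... | inj₁ e<n = cong₂ ℤ._+_ (Σ<-single n e f e<n (λ i i<n → f≗0 i (ℕₚ.m<n⇒m<1+n i<n)))
                             (f≗0 n ℕₚ.≤-refl (λ n≡e → ℕₚ.<-irrefl (sym n≡e) e<n))
                 ⟨ trans ⟩ ℤₚ.+-identityʳ (f e)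
... | inj₂ refl = cong (ℤ._+ f e) (Σ<-zero n (λ i i<n → f≗0 i (ℕₚ.m<n⇒m<1+n i<n) (ℕₚ.<⇒≢ i<n)))
                  ⟨ trans ⟩ ℤₚ.+-identityˡ (f e)

-- The region {(i , s) | i ≤ s ≤ N} summed by columns and by rows.
Σ<-triangle : ∀ N (G : ℕ → ℕ → ℤ) →
              Σ< (suc N) (λ s → Σ< (suc s) (λ i → G i s)) ≡ Σ< (suc N) (λ i → Σ< (suc (N ∸ i)) (λ t → G i (i ℕ.+ t)))
Σ<-triangle N G = begin
  Σ< (suc N) (λ s → Σ< (suc s) (λ i → G i s))        ≡⟨ Σ<-cong (suc N) (λ s s≤N → sym (column s (ℕₚ.≤-pred s≤N))) ⟩
  Σ< (suc N) (λ s → Σ< (suc N) (λ i → H i s))        ≡⟨ Σ<-swap (suc N) (suc N) (λ s i → H i s) ⟩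
  Σ< (suc N) (λ i → Σ< (suc N) (λ s → H i s))        ≡⟨ Σ<-cong (suc N) (λ i i≤N → row i (ℕₚ.≤-pred i≤N)) ⟩
  Σ< (suc N) (λ i → Σ< (suc (N ∸ i)) (λ t → G i (i ℕ.+ t))) ∎
  where
  H : ℕ → ℕ → ℤ
  H i s = if i ≤ᵇ s then G i s else 0ℤ

  column : ∀ s → s ≤ N → Σ< (suc N) (λ i → H i s) ≡ Σ< (suc s) (λ i → G i s)
  column s s≤N =
    Σ<-extend (λ i → H i s) (s≤s s≤N) (λ i s<i → cong (λ b → if b then G i s else 0ℤ) (dec-false (i ℕ.≤? s) (ℕₚ.<⇒≱ s<i)))
    ⟨ trans ⟩ Σ<-cong (suc s) (λ i i≤s → cong (λ b → if b then G i s else 0ℤ) (dec-true (i ℕ.≤? s) (ℕₚ.≤-pred i≤s)))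

  row : ∀ i → i ≤ N → Σ< (suc N) (λ s → H i s) ≡ Σ< (suc (N ∸ i)) (λ t → G i (i ℕ.+ t))
  row i i≤N = begin
    Σ< (suc N) (H i)                                        ≡⟨ cong (λ n → Σ< n (H i)) (ℕₚ.+-suc i (N ∸ i) ⟨ trans ⟩ cong suc (ℕₚ.m+[n∸m]≡n i≤N)) ⟨
    Σ< (i ℕ.+ suc (N ∸ i)) (H i)                            ≡⟨ Σ<-split i (suc (N ∸ i)) (H i) ⟩
    Σ< i (H i) ℤ.+ Σ< (suc (N ∸ i)) (λ t → H i (i ℕ.+ t))   ≡⟨ cong₂ ℤ._+_ (Σ<-zero i below) (Σ<-cong (suc (N ∸ i)) above) ⟩
    0ℤ ℤ.+ Σ< (suc (N ∸ i)) (λ t → G i (i ℕ.+ t))           ≡⟨ ℤₚ.+-identityˡ _ ⟩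
    Σ< (suc (N ∸ i)) (λ t → G i (i ℕ.+ t))                  ∎
    where
    below : ∀ s → s < i → H i s ≡ 0ℤ
    below s s<i = cong (λ b → if b then G i s else 0ℤ) (dec-false (i ℕ.≤? s) (ℕₚ.<⇒≱ s<i))
    above : ∀ t → t < suc (N ∸ i) → H i (i ℕ.+ t) ≡ G i (i ℕ.+ t)
    above t _ = cong (λ b → if b then G i (i ℕ.+ t) else 0ℤ) (dec-true (i ℕ.≤? i ℕ.+ t) (ℕₚ.m≤m+n i t))

zeroPS : PS
zeroPS _ = 0ℤ

ΣPS : ℕ → (ℕ → PS) → PS
ΣPS n F N = Σ< n (λ i → F i N)

≋-refl : ∀ {f} → f ≋ f
≋-refl N = refl

≋-sym : ∀ {f g} → f ≋ g → g ≋ f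
≋-sym f≋g N = sym (f≋g N)

≋-trans : ∀ {f g h} → f ≋ g → g ≋ h → f ≋ h
≋-trans f≋g g≋h N = trans (f≋g N) (g≋h N)

≡⇒≋ : ∀ {f g} → f ≡ g → f ≋ g
≡⇒≋ refl = ≋-refl

⊕-cong : ∀ {f f′ g g′} → f ≋ f′ → g ≋ g′ → f ⊕ g ≋ f′ ⊕ g′
⊕-cong f≋f′ g≋g′ N = cong₂ ℤ._+_ (f≋f′ N) (g≋g′ N)

⊕-congʳ : ∀ f {g g′} → g ≋ g′ → f ⊕ g ≋ f ⊕ g′
⊕-congʳ f = ⊕-cong {f} ≋-refl

⊛-cong : ∀ {f f′ g g′} → f ≋ f′ → g ≋ g′ → f ⊛ g ≋ f′ ⊛ g′
⊛-cong f≋f′ g≋g′ N = Σ<-cong (suc N) (λ i _ → cong₂ ℤ._*_ (f≋f′ i) (g≋g′ (N ∸ i)))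

⊛-congˡ : ∀ {f f′} g → f ≋ f′ → f ⊛ g ≋ f′ ⊛ g
⊛-congˡ g f≋f′ = ⊛-cong f≋f′ (≋-refl {g})

⊛-congʳ : ∀ f {g g′} → g ≋ g′ → f ⊛ g ≋ f ⊛ g′
⊛-congʳ f = ⊛-cong {f} ≋-refl

⊛-comm : ∀ f g → f ⊛ g ≋ g ⊛ f
⊛-comm f g N = begin
  Σ< (suc N) (λ i → f i ℤ.* g (N ∸ i))                   ≡⟨ Σ<-reverse (suc N) _ ⟩
  Σ< (suc N) (λ i → f (N ∸ i) ℤ.* g (N ∸ (N ∸ i)))       ≡⟨ Σ<-cong (suc N) swap ⟩
  Σ< (suc N) (λ i → g i ℤ.* f (N ∸ i))                   ∎
  where
  swap : ∀ i → i < suc N → f (N ∸ i) ℤ.* g (N ∸ (N ∸ i)) ≡ g i ℤ.* f (N ∸ i)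
  swap i i≤N = cong (λ j → f (N ∸ i) ℤ.* g j) (ℕₚ.m∸[m∸n]≡n (ℕₚ.≤-pred i≤N)) ⟨ trans ⟩ ℤₚ.*-comm (f (N ∸ i)) (g i)

⊛-assoc : ∀ f g h → (f ⊛ g) ⊛ h ≋ f ⊛ (g ⊛ h)
⊛-assoc f g h N = begin
  Σ< (suc N) (λ s → Σ< (suc s) (λ i → f i ℤ.* g (s ∸ i)) ℤ.* h (N ∸ s))
    ≡⟨ Σ<-cong (suc N) (λ s _ → sym (Σ<-*ʳ (suc s) (h (N ∸ s)) _)) ⟩
  Σ< (suc N) (λ s → Σ< (suc s) (λ i → f i ℤ.* g (s ∸ i) ℤ.* h (N ∸ s)))
    ≡⟨ Σ<-triangle N (λ i s → f i ℤ.* g (s ∸ i) ℤ.* h (N ∸ s)) ⟩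
  Σ< (suc N) (λ i → Σ< (suc (N ∸ i)) (λ t → f i ℤ.* g (i ℕ.+ t ∸ i) ℤ.* h (N ∸ (i ℕ.+ t))))
    ≡⟨ Σ<-cong (suc N) (λ i _ → Σ<-cong (suc (N ∸ i)) (λ t _ → reindex i t) ⟨ trans ⟩ Σ<-*ˡ (suc (N ∸ i)) (f i) _) ⟩
  Σ< (suc N) (λ i → f i ℤ.* Σ< (suc (N ∸ i)) (λ t → g t ℤ.* h (N ∸ i ∸ t))) ∎
  where
  Σ<-*ʳ : ∀ n (a : ℤ) (f : ℕ → ℤ) → Σ< n (λ i → f i ℤ.* a) ≡ Σ< n f ℤ.* a
  Σ<-*ʳ n a f = Σ<-cong n (λ i _ → ℤₚ.*-comm (f i) a) ⟨ trans ⟩ Σ<-*ˡ n a f ⟨ trans ⟩ ℤₚ.*-comm a (Σ< n f)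
  reindex : ∀ i t → f i ℤ.* g (i ℕ.+ t ∸ i) ℤ.* h (N ∸ (i ℕ.+ t)) ≡ f i ℤ.* (g t ℤ.* h (N ∸ i ∸ t))
  reindex i t = cong₂ (λ x y → f i ℤ.* g x ℤ.* h y) (ℕₚ.m+n∸m≡n i t) (sym (ℕₚ.∸-+-assoc N i t))
                ⟨ trans ⟩ ℤₚ.*-assoc (f i) _ _

⊛-distribˡ : ∀ f g h → f ⊛ (g ⊕ h) ≋ f ⊛ g ⊕ f ⊛ h
⊛-distribˡ f g h N = Σ<-cong (suc N) (λ i _ → ℤₚ.*-distribˡ-+ (f i) (g (N ∸ i)) (h (N ∸ i))) ⟨ trans ⟩ Σ<-+ (suc N) _ _

⊛-zeroʳ : ∀ f → f ⊛ zeroPS ≋ zeroPS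
⊛-zeroʳ f N = Σ<-zero (suc N) (λ i _ → ℤₚ.*-zeroʳ (f i))

⊛-identityˡ : ∀ f → one ⊛ f ≋ f
⊛-identityˡ f N = begin
  (one ⊛ f) N                                              ≡⟨ Σ<-head N _ ⟩
  1ℤ ℤ.* f N ℤ.+ Σ< N (λ i → 0ℤ ℤ.* f (N ∸ suc i))         ≡⟨ cong₂ ℤ._+_ (ℤₚ.*-identityˡ (f N)) (Σ<-zero N (λ _ _ → refl)) ⟩
  f N ℤ.+ 0ℤ                                               ≡⟨ ℤₚ.+-identityʳ (f N) ⟩
  f N                                                      ∎

⊛-identityʳ : ∀ f → f ⊛ one ≋ f
⊛-identityʳ f = ≋-trans (⊛-comm f one) (⊛-identityˡ f)

⊛-commutativeMonoid : CommutativeMonoid 0ℓ 0ℓ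
⊛-commutativeMonoid = record
  { Carrier = PS ; _≈_ = _≋_ ; _∙_ = _⊛_ ; ε = one
  ; isCommutativeMonoid = record
    { isMonoid = record
      { isSemigroup = record
        { isMagma = record
          { isEquivalence = record { refl = ≋-refl ; sym = ≋-sym ; trans = ≋-trans }
          ; ∙-cong = ⊛-cong }
        ; assoc = ⊛-assoc }
      ; identity = ⊛-identityˡ , ⊛-identityʳ }
    ; comm = ⊛-comm } }

open import Algebra.Solver.CommutativeMonoid ⊛-commutativeMonoid using (solve; _⊜_) renaming (_⊕_ to _⊙_)

⊛-ΣPS : ∀ f n F → f ⊛ ΣPS n F ≋ ΣPS n (λ i → f ⊛ F i)
⊛-ΣPS f n F N = Σ<-cong (suc N) (λ j _ → sym (Σ<-*ˡ n (f j) _)) ⟨ trans ⟩ Σ<-swap (suc N) n _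

ΣPS-cong : ∀ n {F G} → (∀ i → i < n → F i ≋ G i) → ΣPS n F ≋ ΣPS n G
ΣPS-cong n F≋G N = Σ<-cong n (λ i i<n → F≋G i i<n N)

mono-same : ∀ e → mono e e ≡ 1ℤ
mono-same e rewrite dec-true (e ℕ.≟ e) refl = refl

mono-other : ∀ {e i} → e ≢ i → mono e i ≡ 0ℤ
mono-other {e} {i} e≢i rewrite dec-false (e ℕ.≟ i) e≢i = refl

mono-⊛-coeff : ∀ e N (f : PS) → e ≤ N → (mono e ⊛ f) N ≡ f (N ∸ e)
mono-⊛-coeff e N f e≤N = begin
  Σ< (suc N) (λ i → mono e i ℤ.* f (N ∸ i))  ≡⟨ Σ<-single (suc N) e _ (s≤s e≤N) (λ i _ i≢e → cong (ℤ._* f (N ∸ i)) (mono-other (i≢e ∘ sym))) ⟩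
  mono e e ℤ.* f (N ∸ e)                     ≡⟨ cong (ℤ._* f (N ∸ e)) (mono-same e) ⟩
  1ℤ ℤ.* f (N ∸ e)                           ≡⟨ ℤₚ.*-identityˡ _ ⟩
  f (N ∸ e)                                  ∎

mono-⊛-coeff-< : ∀ e N (f : PS) → N < e → (mono e ⊛ f) N ≡ 0ℤ
mono-⊛-coeff-< e N f N<e = Σ<-zero (suc N) (λ i i≤N →
  cong (ℤ._* f (N ∸ i)) (mono-other (λ e≡i → ℕₚ.<⇒≱ N<e (ℕₚ.≤-trans (ℕₚ.≤-reflexive e≡i) (ℕₚ.≤-pred i≤N)))))

mono-zero : mono 0 ≋ one
mono-zero zero    = refl
mono-zero (suc N) = refl

mono-zero-⊛ : ∀ f → mono 0 ⊛ f ≋ f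
mono-zero-⊛ f = ≋-trans (⊛-congˡ f mono-zero) (⊛-identityˡ f)

mono-+ : ∀ a b → mono a ⊛ mono b ≋ mono (a ℕ.+ b)
mono-+ a b N with a ℕ.≤? N
... | no a≰N = mono-⊛-coeff-< a N (mono b) (ℕₚ.≰⇒> a≰N)
               ⟨ trans ⟩ sym (mono-other (λ a+b≡N → a≰N (subst (a ≤_) a+b≡N (ℕₚ.m≤m+n a b))))
... | yes a≤N = mono-⊛-coeff a N (mono b) a≤N ⟨ trans ⟩ shifted (b ℕ.≟ N ∸ a)
  where
  a+[N∸a]≡N : a ℕ.+ (N ∸ a) ≡ N
  a+[N∸a]≡N = ℕₚ.m+[n∸m]≡n a≤N
  shifted : Dec (b ≡ N ∸ a) → mono b (N ∸ a) ≡ mono (a ℕ.+ b) N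
  shifted (yes refl) = mono-same b ⟨ trans ⟩ sym (cong (mono (a ℕ.+ b)) (sym a+[N∸a]≡N) ⟨ trans ⟩ mono-same (a ℕ.+ b))
  shifted (no b≢N∸a) = mono-other b≢N∸a
                       ⟨ trans ⟩ sym (mono-other (λ a+b≡N → b≢N∸a (sym (cong (_∸ a) (sym a+b≡N) ⟨ trans ⟩ ℕₚ.m+n∸m≡n a b))))

mono-⊛-mono : ∀ a b f → mono a ⊛ (mono b ⊛ f) ≋ mono (a ℕ.+ b) ⊛ f
mono-⊛-mono a b f = ≋-trans (≋-sym (⊛-assoc (mono a) (mono b) f)) (⊛-congˡ f (mono-+ a b))

geomInv-unfold : ∀ d → geomInv d ≋ one ⊕ mono (suc d) ⊛ geomInv d
geomInv-unfold d zero = cong (λ x → 1ℤ ℤ.+ x) (mono-⊛-coeff-< (suc d) 0 (geomInv d) (s≤s z≤n))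
geomInv-unfold d (suc n) with suc d ℕ.≤? suc n
... | yes d<1+n rewrite mono-⊛-coeff (suc d) (suc n) (geomInv d) d<1+n
                      | m≤n⇒[n∸m]%m≡n%m {suc d} {suc n} d<1+n = sym (ℤₚ.+-identityˡ _)
... | no d≮1+n rewrite mono-⊛-coeff-< (suc d) (suc n) (geomInv d) (ℕₚ.≰⇒> d≮1+n)
                     | m<n⇒m%n≡m (ℕₚ.≰⇒> d≮1+n) = refl

geometric-⊛-unfold : ∀ g x → g ≋ one ⊕ x ⊛ g → ∀ X → g ⊛ X ≋ X ⊕ x ⊛ (g ⊛ X)
geometric-⊛-unfold g x g-unfold X =
  ≋-trans (⊛-congˡ X g-unfold)
  (≋-trans (⊛-comm (one ⊕ x ⊛ g) X)
  (≋-trans (⊛-distribˡ X one (x ⊛ g))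
  (⊕-cong (⊛-identityʳ X) (solve 3 (λ X x g → X ⊙ (x ⊙ g) ⊜ x ⊙ (g ⊙ X)) ≋-refl X x g))))

mono-⊛-coeff-+ : ∀ s e n (f : PS) → (mono (s ℕ.+ e) ⊛ f) (s ℕ.+ n) ≡ (mono e ⊛ f) n
mono-⊛-coeff-+ s e n f = begin
  (mono (s ℕ.+ e) ⊛ f) (s ℕ.+ n)    ≡⟨ mono-⊛-mono s e f (s ℕ.+ n) ⟨
  (mono s ⊛ (mono e ⊛ f)) (s ℕ.+ n) ≡⟨ mono-⊛-coeff s (s ℕ.+ n) (mono e ⊛ f) (ℕₚ.m≤m+n s n) ⟩
  (mono e ⊛ f) (s ℕ.+ n ∸ s)        ≡⟨ cong (mono e ⊛ f) (ℕₚ.m+n∸m≡n s n) ⟩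
  (mono e ⊛ f) n                    ∎

module _ (p : ℕ) (X : PS) where
  private
    s : ℕ
    s = suc p

    sum-from-tail : ∀ n → Σ< n (λ c → (mono (suc c ℕ.* s) ⊛ X) n) ≡ (mono s ⊛ (geomInv p ⊛ X)) n →
                    Σ< (suc n) (λ c → (mono (c ℕ.* s) ⊛ X) n) ≡ (geomInv p ⊛ X) n
    sum-from-tail n tail-n =
      Σ<-head n _ ⟨ trans ⟩ cong₂ ℤ._+_ (mono-zero-⊛ X n) tail-n ⟨ trans ⟩ sym (geometric-⊛-unfold (geomInv p) (mono s) (geomInv-unfold p) X n)

  -- The c-th term of the tail vanishes at degree n once c > n, so the tail at
  -- degree s + n′ is the full sum at degree n′.
  geometric-tail : ∀ n → Σ< n (λ c → (mono (suc c ℕ.* s) ⊛ X) n) ≡ (mono s ⊛ (geomInv p ⊛ X)) n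
  geometric-tail = <-rec _ tail
    where
    tail : ∀ n → (∀ {m} → m < n → Σ< m (λ c → (mono (suc c ℕ.* s) ⊛ X) m) ≡ (mono s ⊛ (geomInv p ⊛ X)) m) →
           Σ< n (λ c → (mono (suc c ℕ.* s) ⊛ X) n) ≡ (mono s ⊛ (geomInv p ⊛ X)) n
    tail n rec with s ℕ.≤? n
    ... | no n<s = Σ<-zero n (λ c _ → mono-⊛-coeff-< (suc c ℕ.* s) n X (ℕₚ.<-≤-trans (ℕₚ.≰⇒> n<s) (ℕₚ.m≤m+n s _)))
                   ⟨ trans ⟩ sym (mono-⊛-coeff-< s n (geomInv p ⊛ X) (ℕₚ.≰⇒> n<s))
    ... | yes s≤n with n′ ← n ∸ s | refl ← sym (ℕₚ.m+[n∸m]≡n s≤n) = begin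
      Σ< (s ℕ.+ n′) (λ c → (mono (s ℕ.+ c ℕ.* s) ⊛ X) (s ℕ.+ n′)) ≡⟨ Σ<-cong (s ℕ.+ n′) (λ c _ → mono-⊛-coeff-+ s (c ℕ.* s) n′ X) ⟩
      Σ< (s ℕ.+ n′) (λ c → (mono (c ℕ.* s) ⊛ X) n′)               ≡⟨ Σ<-extend (λ c → (mono (c ℕ.* s) ⊛ X) n′) (s≤s (ℕₚ.m≤n+m n′ p)) vanish ⟩
      Σ< (suc n′) (λ c → (mono (c ℕ.* s) ⊛ X) n′)                 ≡⟨ sum-from-tail n′ (rec (ℕₚ.m<n+m n′ (s≤s z≤n))) ⟩
      (geomInv p ⊛ X) n′                                           ≡⟨ cong (geomInv p ⊛ X) (ℕₚ.m+n∸m≡n s n′) ⟨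
      (geomInv p ⊛ X) (s ℕ.+ n′ ∸ s)                               ≡⟨ mono-⊛-coeff s (s ℕ.+ n′) (geomInv p ⊛ X) (ℕₚ.m≤m+n s n′) ⟨
      (mono s ⊛ (geomInv p ⊛ X)) (s ℕ.+ n′)                        ∎
      where
      vanish : ∀ c → suc n′ ≤ c → (mono (c ℕ.* s) ⊛ X) n′ ≡ 0ℤ
      vanish c n′<c = mono-⊛-coeff-< (c ℕ.* s) n′ X (ℕₚ.<-≤-trans n′<c (ℕₚ.m≤m*n c s))

  geometric-sum : ∀ n → Σ< (suc n) (λ c → (mono (c ℕ.* s) ⊛ X) n) ≡ (geomInv p ⊛ X) n
  geometric-sum n = sum-from-tail n (geometric-tail n)

sumOver : {A : Set} → (A → ℤ) → List A → ℤ
sumOver f []       = 0ℤ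
sumOver f (x ∷ xs) = f x ℤ.+ sumOver f xs

module _ {A : Set} where

  sumOver-cong : ∀ {f g : A → ℤ} xs → (∀ x → f x ≡ g x) → sumOver f xs ≡ sumOver g xs
  sumOver-cong []       f≗g = refl
  sumOver-cong (x ∷ xs) f≗g = cong₂ ℤ._+_ (f≗g x) (sumOver-cong xs f≗g)

  sumOver-congᴬˡˡ : ∀ {P : A → Set} {f g : A → ℤ} {xs} → (∀ x → P x → f x ≡ g x) → All P xs → sumOver f xs ≡ sumOver g xs
  sumOver-congᴬˡˡ f≗g []                  = refl
  sumOver-congᴬˡˡ {xs = x ∷ _} f≗g (px ∷ pxs) = cong₂ ℤ._+_ (f≗g x px) (sumOver-congᴬˡˡ f≗g pxs)

  sumOver-zero : ∀ xs → sumOver {A} (λ _ → 0ℤ) xs ≡ 0ℤ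
  sumOver-zero []       = refl
  sumOver-zero (x ∷ xs) = ℤₚ.+-identityˡ _ ⟨ trans ⟩ sumOver-zero xs

  sumOver-++ : ∀ (f : A → ℤ) xs ys → sumOver f (xs ++ ys) ≡ sumOver f xs ℤ.+ sumOver f ys
  sumOver-++ f []       ys = sym (ℤₚ.+-identityˡ _)
  sumOver-++ f (x ∷ xs) ys = cong (λ t → f x ℤ.+ t) (sumOver-++ f xs ys) ⟨ trans ⟩ sym (ℤₚ.+-assoc (f x) _ _)

  sumOver-+ : ∀ (f g : A → ℤ) xs → sumOver (λ x → f x ℤ.+ g x) xs ≡ sumOver f xs ℤ.+ sumOver g xs
  sumOver-+ f g []       = refl
  sumOver-+ f g (x ∷ xs) = cong (λ t → f x ℤ.+ g x ℤ.+ t) (sumOver-+ f g xs) ⟨ trans ⟩ +-interchange (f x) (g x) _ _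

  sumOver-Σ< : ∀ n (F : ℕ → A → ℤ) xs → sumOver (λ x → Σ< n (λ i → F i x)) xs ≡ Σ< n (λ i → sumOver (F i) xs)
  sumOver-Σ< zero    F xs = sumOver-zero xs
  sumOver-Σ< (suc n) F xs = sumOver-+ _ (F n) xs ⟨ trans ⟩ cong (ℤ._+ sumOver (F n) xs) (sumOver-Σ< n F xs)

  sumOver-applyUpTo : ∀ (f : A → ℤ) (h : ℕ → A) n → sumOver f (applyUpTo h n) ≡ Σ< n (f ∘ h)
  sumOver-applyUpTo f h zero    = refl
  sumOver-applyUpTo f h (suc n) = cong (λ t → f (h 0) ℤ.+ t) (sumOver-applyUpTo f (h ∘ suc) n) ⟨ trans ⟩ sym (Σ<-head n (f ∘ h))

  countIf-sumOver : ∀ (P : A → Bool) xs → + countIf P xs ≡ sumOver (λ x → if P x then 1ℤ else 0ℤ) xs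
  countIf-sumOver P []       = refl
  countIf-sumOver P (x ∷ xs) with P x
  ... | true  = ℤₚ.pos-+ 1 (countIf P xs) ⟨ trans ⟩ cong (λ t → 1ℤ ℤ.+ t) (countIf-sumOver P xs)
  ... | false = countIf-sumOver P xs ⟨ trans ⟩ sym (ℤₚ.+-identityˡ _)

module _ {A B : Set} where

  sumOver-map : ∀ (f : B → ℤ) (h : A → B) xs → sumOver f (map h xs) ≡ sumOver (f ∘ h) xs
  sumOver-map f h []       = refl
  sumOver-map f h (x ∷ xs) = cong (λ t → f (h x) ℤ.+ t) (sumOver-map f h xs)

  sumOver-concatMap : ∀ (f : B → ℤ) (g : A → List B) xs → sumOver f (concatMap g xs) ≡ sumOver (sumOver f ∘ g) xs
  sumOver-concatMap f g []       = refl
  sumOver-concatMap f g (x ∷ xs) = sumOver-++ f (g x) (concatMap g xs) ⟨ trans ⟩ cong (λ t → sumOver f (g x) ℤ.+ t) (sumOver-concatMap f g xs)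

prepend : ℕ → ℕ → List ℕ → List ℕ
prepend c s l = replicate c s ++ l

partitionGF : (List ℕ → ℤ) → ℕ → PS
partitionGF f p n = sumOver f (partsBounded p n)

partitionGF-cong : ∀ {f g} p → (∀ l → f l ≡ g l) → partitionGF f p ≋ partitionGF g p
partitionGF-cong p f≗g n = sumOver-cong (partsBounded p n) f≗g

partitionGF-zero : ∀ p → partitionGF (λ _ → 0ℤ) p ≋ zeroPS
partitionGF-zero p n = sumOver-zero (partsBounded p n)

partitionGF-suc : ∀ f p n → partitionGF f (suc p) n ≡ Σ< (suc n) (λ c → (mono (c ℕ.* suc p) ⊛ partitionGF (f ∘ prepend c (suc p)) p) n)
partitionGF-suc f p n = begin
  sumOver f (concatMap block (upTo (suc n)))  ≡⟨ sumOver-concatMap f block (upTo (suc n)) ⟩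
  sumOver (sumOver f ∘ block) (upTo (suc n)) ≡⟨ sumOver-applyUpTo (sumOver f ∘ block) id (suc n) ⟩
  Σ< (suc n) (sumOver f ∘ block)             ≡⟨ Σ<-cong (suc n) (λ c _ → block-sum c) ⟩
  Σ< (suc n) (λ c → (mono (c ℕ.* suc p) ⊛ partitionGF (f ∘ prepend c (suc p)) p) n) ∎
  where
  block : ℕ → List (List ℕ)
  block c = if n ℕ.<ᵇ c ℕ.* suc p then [] else map (prepend c (suc p)) (partsBounded p (n ∸ c ℕ.* suc p))
  block-sum : ∀ c → sumOver f (block c) ≡ (mono (c ℕ.* suc p) ⊛ partitionGF (f ∘ prepend c (suc p)) p) n
  block-sum c with n ℕ.<? c ℕ.* suc p
  ... | yes n<cs rewrite dec-true (n ℕ.<? c ℕ.* suc p) n<cs = sym (mono-⊛-coeff-< (c ℕ.* suc p) n (partitionGF (f ∘ prepend c (suc p)) p) n<cs)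
  ... | no n≮cs rewrite dec-false (n ℕ.<? c ℕ.* suc p) n≮cs =
    sumOver-map f (prepend c (suc p)) (partsBounded p (n ∸ c ℕ.* suc p))
    ⟨ trans ⟩ sym (mono-⊛-coeff (c ℕ.* suc p) n (partitionGF (f ∘ prepend c (suc p)) p) (ℕₚ.≮⇒≥ n≮cs))

partitionGF-suc-invariant : ∀ f p → (∀ c l → f (prepend c (suc p) l) ≡ f l) → partitionGF f (suc p) ≋ geomInv p ⊛ partitionGF f p
partitionGF-suc-invariant f p invariant n =
  partitionGF-suc f p n
  ⟨ trans ⟩ Σ<-cong (suc n) (λ c _ → ⊛-congʳ (mono (c ℕ.* suc p)) (partitionGF-cong p (invariant c)) n)
  ⟨ trans ⟩ geometric-sum p (partitionGF f p) n

partitionGF-suc-split : ∀ f g p → (∀ c l → f (prepend (suc c) (suc p) l) ≡ g l) →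
                        partitionGF f (suc p) ≋ partitionGF f p ⊕ mono (suc p) ⊛ (geomInv p ⊛ partitionGF g p)
partitionGF-suc-split f g p f≗g n =
  partitionGF-suc f p n
  ⟨ trans ⟩ Σ<-head n _
  ⟨ trans ⟩ cong₂ ℤ._+_ (mono-zero-⊛ (partitionGF f p) n)
                        (Σ<-cong n (λ c _ → ⊛-congʳ (mono (suc c ℕ.* suc p)) (partitionGF-cong p (f≗g c)) n)
                         ⟨ trans ⟩ geometric-tail p (partitionGF g p) n)

partitionGF-suc-bounded : ∀ f p J (F : ℕ → List ℕ → ℤ) →
                          (∀ c l → c ≤ J → f (prepend c (suc p) l) ≡ F (J ∸ c) l) →
                          (∀ c l → J < c → f (prepend c (suc p) l) ≡ 0ℤ) →
                          partitionGF f (suc p) ≋ ΣPS (suc J) (λ c → mono (c ℕ.* suc p) ⊛ partitionGF (F (J ∸ c)) p)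
partitionGF-suc-bounded f p J F f≗F f≗0 n = begin
  partitionGF f (suc p) n   ≡⟨ partitionGF-suc f p n ⟩
  Σ< (suc n) U              ≡⟨ Σ<-extend U (ℕₚ.m≤m+n (suc n) (suc J)) beyond-n ⟨
  Σ< (suc n ℕ.+ suc J) U    ≡⟨ cong (λ k → Σ< k U) (ℕₚ.+-comm (suc n) (suc J)) ⟩
  Σ< (suc J ℕ.+ suc n) U    ≡⟨ Σ<-extend U (ℕₚ.m≤m+n (suc J) (suc n)) beyond-J ⟩
  Σ< (suc J) U              ≡⟨ Σ<-cong (suc J) (λ c c≤J → ⊛-congʳ (mono (c ℕ.* suc p)) (partitionGF-cong p (λ l → f≗F c l (ℕₚ.≤-pred c≤J))) n) ⟩
  ΣPS (suc J) (λ c → mono (c ℕ.* suc p) ⊛ partitionGF (F (J ∸ c)) p) n ∎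
  where
  U : ℕ → ℤ
  U c = (mono (c ℕ.* suc p) ⊛ partitionGF (f ∘ prepend c (suc p)) p) n
  beyond-n : ∀ c → suc n ≤ c → U c ≡ 0ℤ
  beyond-n c n<c = mono-⊛-coeff-< (c ℕ.* suc p) n (partitionGF (f ∘ prepend c (suc p)) p) (ℕₚ.<-≤-trans n<c (ℕₚ.m≤m*n c (suc p)))
  beyond-J : ∀ c → suc J ≤ c → U c ≡ 0ℤ
  beyond-J c J<c = ⊛-congʳ (mono (c ℕ.* suc p)) (≋-trans (partitionGF-cong p (λ l → f≗0 c l J<c)) (partitionGF-zero p)) n
                   ⟨ trans ⟩ ⊛-zeroʳ (mono (c ℕ.* suc p)) n

partitionGF-one : ∀ f n → partitionGF f 1 n ≡ f (prepend n 1 [])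
partitionGF-one f n =
  partitionGF-suc f 0 n ⟨ trans ⟩ Σ<-single (suc n) n term ℕₚ.≤-refl others ⟨ trans ⟩ ones-only
  where
  term : ℕ → ℤ
  term c = (mono (c ℕ.* 1) ⊛ partitionGF (f ∘ prepend c 1) 0) n
  others : ∀ c → c < suc n → c ≢ n → term c ≡ 0ℤ
  others c c≤n c≢n with c<n ← ℕₚ.≤∧≢⇒< (ℕₚ.≤-pred c≤n) c≢n rewrite ℕₚ.*-identityʳ c =
    mono-⊛-coeff c n (partitionGF (f ∘ prepend c 1) 0) (ℕₚ.<⇒≤ c<n) ⟨ trans ⟩ no-partition (n ∸ c) (ℕₚ.m<n⇒0<n∸m c<n)
    where
    no-partition : ∀ m → 0 < m → partitionGF (f ∘ prepend c 1) 0 m ≡ 0ℤ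
    no-partition (suc _) _ = refl
  ones-only : term n ≡ f (prepend n 1 [])
  ones-only rewrite ℕₚ.*-identityʳ n =
    mono-⊛-coeff n n (partitionGF (f ∘ prepend n 1) 0) ℕₚ.≤-refl
    ⟨ trans ⟩ cong (partitionGF (f ∘ prepend n 1) 0) (ℕₚ.n∸n≡0 n) ⟨ trans ⟩ ℤₚ.+-identityʳ _

≡ᵇ-comm : ∀ m n → (m ≡ᵇ n) ≡ (n ≡ᵇ m)
≡ᵇ-comm m n = does-⇔ (mk⇔ sym sym) (m ℕ.≟ n) (n ℕ.≟ m)

+-≡ᵇ-∸ : ∀ {c J} x → c ≤ J → (c ℕ.+ x ≡ᵇ J) ≡ (x ≡ᵇ J ∸ c)
+-≡ᵇ-∸ {c} {J} x c≤J = does-⇔ (mk⇔ to from) (c ℕ.+ x ℕ.≟ J) (x ℕ.≟ J ∸ c)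
  where
  to : c ℕ.+ x ≡ J → x ≡ J ∸ c
  to eq = sym (ℕₚ.m+n∸m≡n c x) ⟨ trans ⟩ cong (_∸ c) eq
  from : x ≡ J ∸ c → c ℕ.+ x ≡ J
  from eq = cong (c ℕ.+_) eq ⟨ trans ⟩ ℕₚ.m+[n∸m]≡n c≤J

+-≡ᵇ-> : ∀ {c J} x → J < c → (c ℕ.+ x ≡ᵇ J) ≡ false
+-≡ᵇ-> {c} {J} x J<c = dec-false (c ℕ.+ x ℕ.≟ J) (λ eq → ℕₚ.<⇒≱ J<c (subst (c ≤_) eq (ℕₚ.m≤m+n c x)))

⊔-≤ᵇ : ∀ {s m} x → s ≤ m → (s ⊔ x ≤ᵇ m) ≡ (x ≤ᵇ m)
⊔-≤ᵇ {s} {m} x s≤m = does-⇔ (mk⇔ (ℕₚ.≤-trans (ℕₚ.m≤n⊔m s x)) (ℕₚ.⊔-lub s≤m)) (s ⊔ x ℕ.≤? m) (x ℕ.≤? m)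

⊔-≡ᵇ-< : ∀ {s m} x → s < m → (s ⊔ x ≡ᵇ m) ≡ (x ≡ᵇ m)
⊔-≡ᵇ-< {s} {m} x s<m = does-⇔ (mk⇔ to from) (s ⊔ x ℕ.≟ m) (x ℕ.≟ m)
  where
  to : s ⊔ x ≡ m → x ≡ m
  to eq with ℕₚ.⊔-sel s x
  ... | inj₁ s⊔x≡s = contradiction (sym s⊔x≡s ⟨ trans ⟩ eq) (ℕₚ.<⇒≢ s<m)
  ... | inj₂ s⊔x≡x = sym s⊔x≡x ⟨ trans ⟩ eq
  from : x ≡ m → s ⊔ x ≡ m
  from refl = ℕₚ.m≤n⇒m⊔n≡n (ℕₚ.<⇒≤ s<m)

⊔-≡ᵇ-self : ∀ m x → (m ⊔ x ≡ᵇ m) ≡ (x ≤ᵇ m)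
⊔-≡ᵇ-self m x = does-⇔ (mk⇔ (λ eq → ℕₚ.≤-trans (ℕₚ.m≤n⊔m m x) (ℕₚ.≤-reflexive eq)) ℕₚ.m≥n⇒m⊔n≡m) (m ⊔ x ℕ.≟ m) (x ℕ.≤? m)

⊔-≡ᵇ-> : ∀ {s m} x → m < s → (s ⊔ x ≡ᵇ m) ≡ false
⊔-≡ᵇ-> {s} {m} x m<s = dec-false (s ⊔ x ℕ.≟ m) (λ eq → ℕₚ.<⇒≱ m<s (ℕₚ.≤-trans (ℕₚ.m≤m⊔n s x) (ℕₚ.≤-reflexive eq)))

countIf-prepend : ∀ (P : ℕ → Bool) c s l → countIf P (prepend c s l) ≡ (if P s then c else 0) ℕ.+ countIf P l
countIf-prepend P zero    s l with P s
... | true  = refl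
... | false = refl
countIf-prepend P (suc c) s l rewrite countIf-prepend P c s l with P s
... | true  = refl
... | false = refl

ω-prepend-one : ∀ c l → ω (prepend c 1 l) ≡ c ℕ.+ ω l
ω-prepend-one c l = countIf-prepend (_≡ᵇ 1) c 1 l

ω-prepend : ∀ c {s} l → 2 ≤ s → ω (prepend c s l) ≡ ω l
ω-prepend c {s} l 2≤s rewrite countIf-prepend (_≡ᵇ 1) c s l | dec-false (s ℕ.≟ 1) (ℕₚ.>⇒≢ 2≤s) = refl

ω-prepend-≤ : ∀ c s l → ω (prepend c s l) ≤ c ℕ.+ ω l
ω-prepend-≤ c s l rewrite countIf-prepend (_≡ᵇ 1) c s l with s ≡ᵇ 1
... | true  = ℕₚ.≤-refl
... | false = ℕₚ.m≤n+m (ω l) c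

-- μ λ = countAbove (ω λ) λ
countAbove : ℕ → List ℕ → ℕ
countAbove w = countIf (w ℕ.<ᵇ_)

countAbove-prepend-> : ∀ {w s} c l → w < s → countAbove w (prepend c s l) ≡ c ℕ.+ countAbove w l
countAbove-prepend-> {w} {s} c l w<s rewrite countIf-prepend (w ℕ.<ᵇ_) c s l | dec-true (w ℕ.<? s) w<s = refl

countAbove-prepend-≤ : ∀ {w s} c l → s ≤ w → countAbove w (prepend c s l) ≡ countAbove w l
countAbove-prepend-≤ {w} {s} c l s≤w rewrite countIf-prepend (w ℕ.<ᵇ_) c s l | dec-false (w ℕ.<? s) (ℕₚ.≤⇒≯ s≤w) = refl

largestPart-prepend : ∀ c s l → largestPart (prepend (suc c) s l) ≡ s ⊔ largestPart l
largestPart-prepend zero    s l = refl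
largestPart-prepend (suc c) s l
  rewrite largestPart-prepend c s l = sym (ℕₚ.⊔-assoc s s (largestPart l)) ⟨ trans ⟩ cong (_⊔ largestPart l) (ℕₚ.⊔-idem s)

indicator : Bool → ℤ
indicator b = if b then 1ℤ else 0ℤ

onesAbove : ℕ → ℕ → List ℕ → ℤ
onesAbove w J l = indicator ((ω l ≡ᵇ w) ∧ (countAbove w l ≡ᵇ J))

onesAbove-prepend-≤ : ∀ {w s} J c l → 2 ≤ s → s ≤ w → onesAbove w J (prepend c s l) ≡ onesAbove w J l
onesAbove-prepend-≤ J c l 2≤s s≤w rewrite ω-prepend c l 2≤s | countAbove-prepend-≤ c l s≤w = refl

onesAbove-prepend-> : ∀ {w s J c} l → 2 ≤ s → w < s → c ≤ J → onesAbove w J (prepend c s l) ≡ onesAbove w (J ∸ c) l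
onesAbove-prepend-> {w} {c = c} l 2≤s w<s c≤J
  rewrite ω-prepend c l 2≤s | countAbove-prepend-> c l w<s | +-≡ᵇ-∸ (countAbove w l) c≤J = refl

onesAbove-prepend-excess : ∀ {w s J c} l → 2 ≤ s → w < s → J < c → onesAbove w J (prepend c s l) ≡ 0ℤ
onesAbove-prepend-excess {w} {c = c} l 2≤s w<s J<c
  rewrite ω-prepend c l 2≤s | countAbove-prepend-> c l w<s | +-≡ᵇ-> (countAbove w l) J<c | ∧-zeroʳ (ω l ≡ᵇ w) = refl

onesAbove-ones : ∀ {w} J n → 1 ≤ w → onesAbove w J (prepend n 1 []) ≡ indicator ((n ≡ᵇ w) ∧ (0 ≡ᵇ J))
onesAbove-ones J n 1≤w rewrite ω-prepend-one n [] | countAbove-prepend-≤ n [] 1≤w | ℕₚ.+-identityʳ n = refl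

-- Partitions into exactly J parts, all in the interval (w, w + d].
exactlyPartsGF : ℕ → ℕ → ℕ → PS
exactlyPartsGF zero    w zero    = one
exactlyPartsGF zero    w (suc J) = zeroPS
exactlyPartsGF (suc d) w J = ΣPS (suc J) (λ c → mono (c ℕ.* suc (w ℕ.+ d)) ⊛ exactlyPartsGF d w (J ∸ c))

-- q^w / (q²;q)_(w-1): partitions with w ones and other parts in [2, w], or with no ones and largest part w
qPoch₂GF : ℕ → PS
qPoch₂GF w = mono w ⊛ invPoch 2 (w ∸ 1)

onesAbove-GF-≤ : ∀ {w} J p → suc p ≤ w → partitionGF (onesAbove w J) (suc p) ≋ (mono w ⊛ invPoch 2 p) ⊛ exactlyPartsGF 0 w J
onesAbove-GF-≤ {w} J zero 1≤w n = partitionGF-one (onesAbove w J) n ⟨ trans ⟩ onesAbove-ones J n 1≤w ⟨ trans ⟩ only-ones J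
  where
  only-ones : ∀ J → indicator ((n ≡ᵇ w) ∧ (0 ≡ᵇ J)) ≡ ((mono w ⊛ one) ⊛ exactlyPartsGF 0 w J) n
  only-ones zero    rewrite ∧-identityʳ (n ≡ᵇ w) | ≡ᵇ-comm n w =
    sym (⊛-identityʳ (mono w ⊛ one) n ⟨ trans ⟩ ⊛-identityʳ (mono w) n)
  only-ones (suc J) rewrite ∧-zeroʳ (n ≡ᵇ w) = sym (⊛-zeroʳ (mono w ⊛ one) n)
onesAbove-GF-≤ {w} J (suc p) p<w =
  ≋-trans (partitionGF-suc-invariant (onesAbove w J) (suc p) (λ c l → onesAbove-prepend-≤ J c l (s≤s (s≤s z≤n)) p<w))
  (≋-trans (⊛-congʳ (geomInv (suc p)) (onesAbove-GF-≤ J p (ℕₚ.<⇒≤ p<w)))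
  (solve 4 (λ g m a z → g ⊙ ((m ⊙ a) ⊙ z) ⊜ (m ⊙ (a ⊙ g)) ⊙ z) ≋-refl (geomInv (suc p)) (mono w) (invPoch 2 p) (exactlyPartsGF 0 w J)))

onesAbove-GF : ∀ {w} → 1 ≤ w → ∀ d J → partitionGF (onesAbove w J) (w ℕ.+ d) ≋ qPoch₂GF w ⊛ exactlyPartsGF d w J
onesAbove-GF {suc w} _ zero J rewrite ℕₚ.+-identityʳ w = onesAbove-GF-≤ J w ℕₚ.≤-refl
onesAbove-GF {w} 1≤w (suc d) J rewrite ℕₚ.+-suc w d =
  ≋-trans (partitionGF-suc-bounded (onesAbove w J) (w ℕ.+ d) J (onesAbove w)
             (λ c l → onesAbove-prepend-> l 2≤s w<s) (λ c l → onesAbove-prepend-excess l 2≤s w<s))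
  (≋-trans (ΣPS-cong (suc J) (λ c _ → ≋-trans (⊛-congʳ (mono (c ℕ.* s)) (onesAbove-GF 1≤w d (J ∸ c)))
                                              (solve 3 (λ x y z → x ⊙ (y ⊙ z) ⊜ y ⊙ (x ⊙ z)) ≋-refl
                                                       (mono (c ℕ.* s)) (qPoch₂GF w) (exactlyPartsGF d w (J ∸ c)))))
  (≋-sym (⊛-ΣPS (qPoch₂GF w) (suc J) (λ c → mono (c ℕ.* s) ⊛ exactlyPartsGF d w (J ∸ c)))))
  where
  s = suc (w ℕ.+ d)
  2≤s : 2 ≤ s
  2≤s = s≤s (ℕₚ.≤-trans 1≤w (ℕₚ.m≤m+n w d))
  w<s : w < s
  w<s = s≤s (ℕₚ.m≤m+n w d)

exactlyPartsGF-no-parts : ∀ d w → exactlyPartsGF d w 0 ≋ one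
exactlyPartsGF-no-parts zero    w   = ≋-refl
exactlyPartsGF-no-parts (suc d) w N = ℤₚ.+-identityˡ _ ⟨ trans ⟩ mono-zero-⊛ (exactlyPartsGF d w 0) N ⟨ trans ⟩ exactlyPartsGF-no-parts d w N

mono-regroup : ∀ c J y X → c ≤ J → mono (c ℕ.* suc (suc y)) ⊛ (mono (J ∸ c) ⊛ X) ≋ mono J ⊛ (mono (c ℕ.* suc y) ⊛ X)
mono-regroup c J y X c≤J =
  ≋-trans (mono-⊛-mono (c ℕ.* suc (suc y)) (J ∸ c) X)
  (≋-trans (⊛-congˡ X (≡⇒≋ (cong mono exponent))) (≋-sym (mono-⊛-mono J (c ℕ.* suc y) X)))
  where
  exponent : c ℕ.* suc (suc y) ℕ.+ (J ∸ c) ≡ J ℕ.+ c ℕ.* suc y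
  exponent with k ← J ∸ c | refl ← sym (ℕₚ.m+[n∸m]≡n c≤J) = distribute c k y
    where
    distribute : ∀ c k y → c ℕ.* suc (suc y) ℕ.+ k ≡ c ℕ.+ k ℕ.+ c ℕ.* suc y
    distribute = ℕ-solve-∀

exactlyPartsGF-lift₁ : ∀ d w J → exactlyPartsGF d (suc w) J ≋ mono J ⊛ exactlyPartsGF d w J
exactlyPartsGF-lift₁ zero    w zero    = ≋-sym (mono-zero-⊛ one)
exactlyPartsGF-lift₁ zero    w (suc J) = ≋-sym (⊛-zeroʳ (mono (suc J)))
exactlyPartsGF-lift₁ (suc d) w J =
  ≋-trans (ΣPS-cong (suc J) (λ c c≤J → ≋-trans (⊛-congʳ (mono (c ℕ.* suc (suc w ℕ.+ d))) (exactlyPartsGF-lift₁ d w (J ∸ c)))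
                                              (mono-regroup c J (w ℕ.+ d) (exactlyPartsGF d w (J ∸ c)) (ℕₚ.≤-pred c≤J))))
  (≋-sym (⊛-ΣPS (mono J) (suc J) (λ c → mono (c ℕ.* suc (w ℕ.+ d)) ⊛ exactlyPartsGF d w (J ∸ c))))

exactlyPartsGF-lift : ∀ d w J → exactlyPartsGF d w J ≋ mono (w ℕ.* J) ⊛ exactlyPartsGF d 0 J
exactlyPartsGF-lift d zero    J = ≋-sym (mono-zero-⊛ (exactlyPartsGF d 0 J))
exactlyPartsGF-lift d (suc w) J =
  ≋-trans (exactlyPartsGF-lift₁ d w J)
  (≋-trans (⊛-congʳ (mono J) (exactlyPartsGF-lift d w J)) (mono-⊛-mono J (w ℕ.* J) (exactlyPartsGF d 0 J)))

-- Removing the first column of the Young diagram: J parts in [1, d + 1] become at most J parts in [1, d].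
exactlyPartsGF-column : ∀ d J → exactlyPartsGF (suc d) 0 J ≋ mono J ⊛ ΣPS (suc J) (exactlyPartsGF d 0)
exactlyPartsGF-column zero J N = begin
  Σ< (suc J) (λ c → (mono (c ℕ.* 1) ⊛ exactlyPartsGF 0 0 (J ∸ c)) N)
    ≡⟨ Σ<-single (suc J) J _ ℕₚ.≤-refl (λ c c≤J c≢J → leftover c (ℕₚ.≤∧≢⇒< (ℕₚ.≤-pred c≤J) c≢J)) ⟩
  (mono (J ℕ.* 1) ⊛ exactlyPartsGF 0 0 (J ∸ J)) N
    ≡⟨ cong₂ (λ a b → (mono a ⊛ exactlyPartsGF 0 0 b) N) (ℕₚ.*-identityʳ J) (ℕₚ.n∸n≡0 J) ⟩
  (mono J ⊛ one) N
    ≡⟨ ⊛-congʳ (mono J) no-parts N ⟩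
  (mono J ⊛ ΣPS (suc J) (exactlyPartsGF 0 0)) N ∎
  where
  no-parts : one ≋ ΣPS (suc J) (exactlyPartsGF 0 0)
  no-parts M = sym (Σ<-head J (λ j → exactlyPartsGF 0 0 j M) ⟨ trans ⟩ cong (λ x → one M ℤ.+ x) (Σ<-zero J (λ _ _ → refl))
                    ⟨ trans ⟩ ℤₚ.+-identityʳ (one M))
  leftover : ∀ c → c < J → (mono (c ℕ.* 1) ⊛ exactlyPartsGF 0 0 (J ∸ c)) N ≡ 0ℤ
  leftover c c<J with J ∸ c | ℕₚ.m<n⇒0<n∸m c<J
  ... | suc _ | _ = ⊛-zeroʳ (mono (c ℕ.* 1)) N
exactlyPartsGF-column (suc d) J =
  ≋-trans (ΣPS-cong (suc J) (λ c c≤J → ≋-trans (⊛-congʳ (mono (c ℕ.* suc (suc d))) (exactlyPartsGF-column d (J ∸ c)))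
                                              (mono-regroup c J d (ΣPS (suc (J ∸ c)) (exactlyPartsGF d 0)) (ℕₚ.≤-pred c≤J))))
  (≋-trans (≋-sym (⊛-ΣPS (mono J) (suc J) (λ c → mono (c ℕ.* suc d) ⊛ ΣPS (suc (J ∸ c)) (exactlyPartsGF d 0))))
  (⊛-congʳ (mono J) by-size))
  where
  by-size : ΣPS (suc J) (λ c → mono (c ℕ.* suc d) ⊛ ΣPS (suc (J ∸ c)) (exactlyPartsGF d 0)) ≋ ΣPS (suc J) (exactlyPartsGF (suc d) 0)
  by-size N = begin
    Σ< (suc J) (λ c → (mono (c ℕ.* suc d) ⊛ ΣPS (suc (J ∸ c)) (exactlyPartsGF d 0)) N)
      ≡⟨ Σ<-cong (suc J) (λ c _ → ⊛-ΣPS (mono (c ℕ.* suc d)) (suc (J ∸ c)) (exactlyPartsGF d 0) N) ⟩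
    Σ< (suc J) (λ c → Σ< (suc (J ∸ c)) (λ t → (mono (c ℕ.* suc d) ⊛ exactlyPartsGF d 0 t) N))
      ≡⟨ Σ<-cong (suc J) (λ c _ → Σ<-cong (suc (J ∸ c)) (λ t _ → cong (λ x → (mono (c ℕ.* suc d) ⊛ exactlyPartsGF d 0 x) N) (sym (ℕₚ.m+n∸m≡n c t)))) ⟩
    Σ< (suc J) (λ c → Σ< (suc (J ∸ c)) (λ t → (mono (c ℕ.* suc d) ⊛ exactlyPartsGF d 0 (c ℕ.+ t ∸ c)) N))
      ≡⟨ Σ<-triangle J (λ c j → (mono (c ℕ.* suc d) ⊛ exactlyPartsGF d 0 (j ∸ c)) N) ⟨
    Σ< (suc J) (λ j → Σ< (suc j) (λ c → (mono (c ℕ.* suc d) ⊛ exactlyPartsGF d 0 (j ∸ c)) N)) ∎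

-- partitions into exactly J parts
exactlyGF : ℕ → PS
exactlyGF J = mono J ⊛ invPoch 1 J

invPoch-one-Σ-exactlyGF : ∀ J → invPoch 1 J ≋ ΣPS (suc J) exactlyGF
invPoch-one-Σ-exactlyGF zero N = sym (ℤₚ.+-identityˡ _ ⟨ trans ⟩ mono-zero-⊛ one N)
invPoch-one-Σ-exactlyGF (suc J) =
  ≋-trans (⊛-congʳ (invPoch 1 J) (geomInv-unfold J))
  (≋-trans (⊛-distribˡ (invPoch 1 J) one (mono (suc J) ⊛ geomInv J))
  (⊕-cong (≋-trans (⊛-identityʳ (invPoch 1 J)) (invPoch-one-Σ-exactlyGF J))
          (solve 3 (λ a b c → a ⊙ (b ⊙ c) ⊜ b ⊙ (a ⊙ c)) ≋-refl (invPoch 1 J) (mono (suc J)) (geomInv J))))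

infix 4 _≈[_]_
_≈[_]_ : PS → ℕ → PS → Set
f ≈[ r ] g = ∀ N → N < r → f N ≡ g N

⊛-≈[] : ∀ h {f g r} → f ≈[ r ] g → h ⊛ f ≈[ r ] h ⊛ g
⊛-≈[] h f≈g N N<r = Σ<-cong (suc N) (λ i _ → cong (h i ℤ.*_) (f≈g (N ∸ i) (ℕₚ.≤-<-trans (ℕₚ.m∸n≤m N i) N<r)))

mono-⊛-≈[] : ∀ e {f g r} → f ≈[ r ] g → mono e ⊛ f ≈[ e ℕ.+ r ] mono e ⊛ g
mono-⊛-≈[] e {f} {g} {r} f≈g N N<e+r with e ℕ.≤? N
... | yes e≤N = mono-⊛-coeff e N f e≤N ⟨ trans ⟩ f≈g (N ∸ e) N∸e<r ⟨ trans ⟩ sym (mono-⊛-coeff e N g e≤N)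
  where
  N∸e<r : N ∸ e < r
  N∸e<r = ℕₚ.+-cancelˡ-< e (N ∸ e) r (subst (_< e ℕ.+ r) (sym (ℕₚ.m+[n∸m]≡n e≤N)) N<e+r)
... | no e≰N = mono-⊛-coeff-< e N f (ℕₚ.≰⇒> e≰N) ⟨ trans ⟩ sym (mono-⊛-coeff-< e N g (ℕₚ.≰⇒> e≰N))

ΣPS-≈[] : ∀ n {F G : ℕ → PS} {r} → (∀ i → i < n → F i ≈[ r ] G i) → ΣPS n F ≈[ r ] ΣPS n G
ΣPS-≈[] n F≈G N N<r = Σ<-cong n (λ i i<n → F≈G i i<n N N<r)

-- Parts larger than d cannot occur below degree d + 1.
exactlyPartsGF-≈[] : ∀ d J → exactlyPartsGF d 0 J ≈[ d ] exactlyGF J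
exactlyPartsGF-≈[] zero    J       N ()
exactlyPartsGF-≈[] (suc d) zero    N _ = exactlyPartsGF-no-parts (suc d) 0 N ⟨ trans ⟩ sym (mono-zero-⊛ one N)
exactlyPartsGF-≈[] (suc d) (suc j) N N<1+d =
  exactlyPartsGF-column d (suc j) N
  ⟨ trans ⟩ mono-⊛-≈[] (suc j) (ΣPS-≈[] (suc (suc j)) (λ i _ → exactlyPartsGF-≈[] d i)) N (ℕₚ.<-≤-trans N<1+d (s≤s (ℕₚ.m≤n+m d j)))
  ⟨ trans ⟩ sym (⊛-congʳ (mono (suc j)) (invPoch-one-Σ-exactlyGF (suc j)) N)

exactlyPartsGF-coeff : ∀ {w J} d → 1 ≤ w → 2 ≤ J → ∀ N → N ≤ w ℕ.+ d → exactlyPartsGF d w J N ≡ (mono (w ℕ.* J) ⊛ exactlyGF J) N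
exactlyPartsGF-coeff {w} {J} d 1≤w 2≤J N N≤w+d =
  exactlyPartsGF-lift d w J N ⟨ trans ⟩ mono-⊛-≈[] (w ℕ.* J) (exactlyPartsGF-≈[] d J) N N<wJ+d
  where
  w<wJ : w < w ℕ.* J
  w<wJ = ℕₚ.m<m*n w J {{ℕ.>-nonZero 1≤w}} 2≤J
  N<wJ+d : N < w ℕ.* J ℕ.+ d
  N<wJ+d = ℕₚ.≤-<-trans N≤w+d (ℕₚ.+-monoˡ-< d w<wJ)

noOnesMax : ℕ → List ℕ → ℤ
noOnesMax m l = indicator ((ω l ≡ᵇ 0) ∧ (largestPart l ≡ᵇ m))

noOnesBounded : ℕ → List ℕ → ℤ
noOnesBounded m l = indicator ((ω l ≡ᵇ 0) ∧ (largestPart l ≤ᵇ m))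

noOnesBounded-GF : ∀ {m} p → suc p ≤ m → partitionGF (noOnesBounded m) (suc p) ≋ invPoch 2 p
noOnesBounded-GF {m} zero    _ zero    = partitionGF-one (noOnesBounded m) 0
noOnesBounded-GF {m} zero    _ (suc n) = partitionGF-one (noOnesBounded m) (suc n)
noOnesBounded-GF {m} (suc p) p<m =
  ≋-trans (partitionGF-suc-invariant (noOnesBounded m) (suc p) invariant)
  (≋-trans (⊛-congʳ (geomInv (suc p)) (noOnesBounded-GF p (ℕₚ.<⇒≤ p<m))) (⊛-comm (geomInv (suc p)) (invPoch 2 p)))
  where
  invariant : ∀ c l → noOnesBounded m (prepend c (2 ℕ.+ p) l) ≡ noOnesBounded m l
  invariant zero    l = refl
  invariant (suc c) l rewrite ω-prepend (suc c) l (s≤s (s≤s (z≤n {p}))) | largestPart-prepend c (2 ℕ.+ p) l | ⊔-≤ᵇ (largestPart l) p<m = refl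

noOnesMax-GF-< : ∀ {m} p → suc p < m → partitionGF (noOnesMax m) (suc p) ≋ zeroPS
noOnesMax-GF-< {m} zero    1<m zero rewrite partitionGF-one (noOnesMax m) 0 | dec-false (0 ℕ.≟ m) (ℕₚ.<⇒≢ (ℕₚ.<-trans (s≤s z≤n) 1<m)) = refl
noOnesMax-GF-< {m} zero    1<m (suc n) = partitionGF-one (noOnesMax m) (suc n)
noOnesMax-GF-< {m} (suc p) p<m =
  ≋-trans (partitionGF-suc-invariant (noOnesMax m) (suc p) invariant)
  (≋-trans (⊛-congʳ (geomInv (suc p)) (noOnesMax-GF-< p (ℕₚ.<-trans (ℕₚ.n<1+n _) p<m))) (⊛-zeroʳ (geomInv (suc p))))
  where
  invariant : ∀ c l → noOnesMax m (prepend c (2 ℕ.+ p) l) ≡ noOnesMax m l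
  invariant zero    l = refl
  invariant (suc c) l rewrite ω-prepend (suc c) l (s≤s (s≤s (z≤n {p}))) | largestPart-prepend c (2 ℕ.+ p) l | ⊔-≡ᵇ-< (largestPart l) p<m = refl

noOnesMax-GF : ∀ k → partitionGF (noOnesMax (2 ℕ.+ k)) (2 ℕ.+ k) ≋ qPoch₂GF (2 ℕ.+ k)
noOnesMax-GF k =
  ≋-trans (partitionGF-suc-split (noOnesMax m) (noOnesBounded m) (suc k) largest-m)
  (≋-trans (⊕-cong (noOnesMax-GF-< k ℕₚ.≤-refl)
                   (⊛-congʳ (mono m) (≋-trans (⊛-congʳ (geomInv (suc k)) (noOnesBounded-GF k (ℕₚ.n≤1+n _)))
                                              (⊛-comm (geomInv (suc k)) (invPoch 2 k)))))
  (ℤₚ.+-identityˡ ∘ qPoch₂GF m))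
  where
  m = 2 ℕ.+ k
  largest-m : ∀ c l → noOnesMax m (prepend (suc c) m l) ≡ noOnesBounded m l
  largest-m c l rewrite ω-prepend (suc c) l (s≤s (s≤s (z≤n {k}))) | largestPart-prepend c m l | ⊔-≡ᵇ-self m (largestPart l) = refl

noOnesMax-GF-> : ∀ {m} → 1 ≤ m → ∀ p → m ≤ p → partitionGF (noOnesMax m) (suc p) ≋ partitionGF (noOnesMax m) p
noOnesMax-GF-> {m} 1≤m p m≤p =
  ≋-trans (partitionGF-suc-split (noOnesMax m) (λ _ → 0ℤ) p too-large)
  (≋-trans (⊕-congʳ (partitionGF (noOnesMax m) p)
             (≋-trans (⊛-congʳ (mono (suc p)) (≋-trans (⊛-congʳ (geomInv p) (partitionGF-zero p)) (⊛-zeroʳ (geomInv p))))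
                      (⊛-zeroʳ (mono (suc p)))))
  (ℤₚ.+-identityʳ ∘ partitionGF (noOnesMax m) p))
  where
  too-large : ∀ c l → noOnesMax m (prepend (suc c) (suc p) l) ≡ 0ℤ
  too-large c l rewrite ω-prepend (suc c) l (s≤s (ℕₚ.≤-trans 1≤m m≤p)) | largestPart-prepend c (suc p) l
                      | ⊔-≡ᵇ-> (largestPart l) (s≤s m≤p) | ∧-zeroʳ (ω l ≡ᵇ 0) = refl

noOnesMax-GF-≥ : ∀ {m} → 1 ≤ m → ∀ p → m ≤ p → partitionGF (noOnesMax m) p ≋ partitionGF (noOnesMax m) m
noOnesMax-GF-≥ {m} 1≤m p m≤p with d ← p ∸ m | refl ← sym (ℕₚ.m+[n∸m]≡n m≤p) = stable d
  where
  stable : ∀ d → partitionGF (noOnesMax m) (m ℕ.+ d) ≋ partitionGF (noOnesMax m) m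
  stable zero    rewrite ℕₚ.+-identityʳ m = ≋-refl
  stable (suc d) rewrite ℕₚ.+-suc m d = ≋-trans (noOnesMax-GF-> 1≤m (m ℕ.+ d) (ℕₚ.m≤m+n m d)) (stable d)

noOnesMax-one-GF : ∀ p → partitionGF (noOnesMax 1) (suc p) ≋ zeroPS
noOnesMax-one-GF zero    zero    = partitionGF-one (noOnesMax 1) 0
noOnesMax-one-GF zero    (suc n) = partitionGF-one (noOnesMax 1) (suc n)
noOnesMax-one-GF (suc p) = ≋-trans (noOnesMax-GF-> ℕₚ.≤-refl (suc p) (s≤s z≤n)) (noOnesMax-one-GF p)

noOnesMax-coeff : ∀ m n → 1 ≤ m → partitionGF (noOnesMax m) (2 ℕ.+ n) (2 ℕ.+ n) ≡ qPoch₂GF m (2 ℕ.+ n)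
noOnesMax-coeff (suc zero) n _ =
  noOnesMax-one-GF (suc n) (2 ℕ.+ n) ⟨ trans ⟩ sym (mono-⊛-coeff 1 (2 ℕ.+ n) one (s≤s z≤n))
noOnesMax-coeff (suc (suc k)) n _ with 2 ℕ.+ k ℕ.≤? 2 ℕ.+ n
... | yes m≤N = noOnesMax-GF-≥ (s≤s z≤n) (2 ℕ.+ n) m≤N (2 ℕ.+ n) ⟨ trans ⟩ noOnesMax-GF k (2 ℕ.+ n)
... | no m≰N = noOnesMax-GF-< (suc n) (ℕₚ.≰⇒> m≰N) (2 ℕ.+ n)
               ⟨ trans ⟩ sym (mono-⊛-coeff-< (2 ℕ.+ k) (2 ℕ.+ n) (invPoch 2 (suc k)) (ℕₚ.≰⇒> m≰N))

ω-partsBounded : ∀ p n → All (λ l → ω l ≤ n) (partsBounded p n)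
ω-partsBounded zero    zero    = z≤n ∷ []
ω-partsBounded zero    (suc n) = []
ω-partsBounded (suc p) n = Allₚ.concat⁺ (Allₚ.map⁺ (Allₚ.applyUpTo⁺₂ id (suc n) block))
  where
  block : ∀ c → All (λ l → ω l ≤ n) (if n ℕ.<ᵇ c ℕ.* suc p then [] else map (prepend c (suc p)) (partsBounded p (n ∸ c ℕ.* suc p)))
  block c with n ℕ.<? c ℕ.* suc p
  ... | yes n<cs rewrite dec-true (n ℕ.<? c ℕ.* suc p) n<cs = []
  ... | no n≮cs rewrite dec-false (n ℕ.<? c ℕ.* suc p) n≮cs = Allₚ.map⁺ (All.map bound (ω-partsBounded p (n ∸ c ℕ.* suc p)))
    where
    bound : ∀ {l} → ω l ≤ n ∸ c ℕ.* suc p → ω (prepend c (suc p) l) ≤ n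
    bound {l} ωl≤ = ℕₚ.≤-trans (ω-prepend-≤ c (suc p) l)
                     (ℕₚ.≤-trans (ℕₚ.+-mono-≤ (ℕₚ.m≤m*n c (suc p)) ωl≤) (ℕₚ.≤-reflexive (ℕₚ.m+[n∸m]≡n (ℕₚ.≮⇒≥ n≮cs))))

crank-≡-μ-ω : ∀ μ w m → does ((+ μ ℤ.- + w) ℤ.≟ + m) ≡ (μ ≡ᵇ m ℕ.+ w)
crank-≡-μ-ω μ w m = does-⇔ (mk⇔ to from) ((+ μ ℤ.- + w) ℤ.≟ + m) (μ ℕ.≟ m ℕ.+ w)
  where
  to : + μ ℤ.- + w ≡ + m → μ ≡ m ℕ.+ w
  to eq = ℤₚ.+-injective (sub-add (+ μ) (+ w) ⟨ trans ⟩ cong (ℤ._+ + w) eq)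
    where
    sub-add : ∀ x y → x ≡ (x ℤ.- y) ℤ.+ y
    sub-add = ℤ-solve-∀
  from : μ ≡ m ℕ.+ w → + μ ℤ.- + w ≡ + m
  from refl = add-sub (+ m) (+ w)
    where
    add-sub : ∀ x y → (x ℤ.+ y) ℤ.- y ≡ x
    add-sub = ℤ-solve-∀

crank-indicator : ∀ m B l → ω l ≤ B →
                  indicator (does (crank l ℤ.≟ + m)) ≡ noOnesMax m l ℤ.+ Σ< B (λ w → onesAbove (suc w) (m ℕ.+ suc w) l)
crank-indicator m B l ωl≤B with ω l in ωl≡
... | zero  = sym (cong (λ x → indicator (largestPart l ≡ᵇ m) ℤ.+ x) (Σ<-zero B (λ w _ → refl)) ⟨ trans ⟩ ℤₚ.+-identityʳ _)
... | suc k = begin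
  indicator (does ((+ μ l ℤ.- + suc k) ℤ.≟ + m))                      ≡⟨ cong indicator (crank-≡-μ-ω (μ l) (suc k) m) ⟩
  indicator (μ l ≡ᵇ m ℕ.+ suc k)                                      ≡⟨ cong (λ w → indicator (countIf (w ℕ.<ᵇ_) l ≡ᵇ m ℕ.+ suc k)) ωl≡ ⟩
  indicator (countAbove (suc k) l ≡ᵇ m ℕ.+ suc k)                     ≡⟨ cong (λ b → indicator (b ∧ (countAbove (suc k) l ≡ᵇ m ℕ.+ suc k))) (dec-true (k ℕ.≟ k) refl) ⟨
  ones-exactly k                                                      ≡⟨ Σ<-single B k ones-exactly ωl≤B other-w ⟨
  Σ< B ones-exactly                                                   ≡⟨ ℤₚ.+-identityˡ _ ⟨
  0ℤ ℤ.+ Σ< B ones-exactly                                            ∎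
  where
  ones-exactly : ℕ → ℤ
  ones-exactly w = indicator ((suc k ≡ᵇ suc w) ∧ (countAbove (suc w) l ≡ᵇ m ℕ.+ suc w))
  other-w : ∀ w → w < B → w ≢ k → ones-exactly w ≡ 0ℤ
  other-w w _ w≢k rewrite dec-false (k ℕ.≟ w) (w≢k ∘ sym) = refl

crankGF-split : ∀ m n → let N = 2 ℕ.+ n in
                crankGF m N ≡ partitionGF (noOnesMax m) N N ℤ.+ Σ< N (λ w → partitionGF (onesAbove (suc w) (m ℕ.+ suc w)) N N)
crankGF-split m n = begin
  + countIf (λ l → does (crank l ℤ.≟ + m)) (partitions N)
    ≡⟨ countIf-sumOver _ (partitions N) ⟩
  sumOver (λ l → indicator (does (crank l ℤ.≟ + m))) (partitions N)
    ≡⟨ sumOver-congᴬˡˡ (crank-indicator m N) (ω-partsBounded N N) ⟩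
  sumOver (λ l → noOnesMax m l ℤ.+ Σ< N (λ w → onesAbove (suc w) (m ℕ.+ suc w) l)) (partitions N)
    ≡⟨ sumOver-+ (noOnesMax m) _ (partitions N) ⟩
  partitionGF (noOnesMax m) N N ℤ.+ sumOver (λ l → Σ< N (λ w → onesAbove (suc w) (m ℕ.+ suc w) l)) (partitions N)
    ≡⟨ cong (λ x → partitionGF (noOnesMax m) N N ℤ.+ x) (sumOver-Σ< N (λ w → onesAbove (suc w) (m ℕ.+ suc w)) (partitions N)) ⟩
  partitionGF (noOnesMax m) N N ℤ.+ Σ< N (λ w → partitionGF (onesAbove (suc w) (m ℕ.+ suc w)) N N) ∎
  where
  N = 2 ℕ.+ n

-- partitions with w ones and crank m
crankOnesGF : ℕ → ℕ → PS
crankOnesGF m w = qPoch₂GF w ⊛ (mono (w ℕ.* (m ℕ.+ w)) ⊛ exactlyGF (m ℕ.+ w))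

onesAbove-coeff : ∀ m w N → suc w ≤ N → 1 ≤ m → partitionGF (onesAbove (suc w) (m ℕ.+ suc w)) N N ≡ crankOnesGF m (suc w) N
onesAbove-coeff m w N w<N 1≤m = begin
  partitionGF (onesAbove k J) N N                ≡⟨ cong (λ p → partitionGF (onesAbove k J) p N) (ℕₚ.m+[n∸m]≡n w<N) ⟨
  partitionGF (onesAbove k J) (k ℕ.+ (N ∸ k)) N  ≡⟨ onesAbove-GF (s≤s z≤n) (N ∸ k) J N ⟩
  (qPoch₂GF k ⊛ exactlyPartsGF (N ∸ k) k J) N    ≡⟨ ⊛-≈[] (qPoch₂GF k) (λ M M≤N → exactlyPartsGF-coeff (N ∸ k) (s≤s z≤n) 2≤J M (below M M≤N)) N ℕₚ.≤-refl ⟩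
  crankOnesGF m k N                              ∎
  where
  k = suc w
  J = m ℕ.+ k
  2≤J : 2 ≤ J
  2≤J = ℕₚ.+-mono-≤ 1≤m (s≤s z≤n)
  below : ∀ M → M < suc N → M ≤ k ℕ.+ (N ∸ k)
  below M M≤N = ℕₚ.≤-trans (ℕₚ.≤-pred M≤N) (ℕₚ.≤-reflexive (sym (ℕₚ.m+[n∸m]≡n w<N)))

-- Unfolding g₀ = 1 + y g₀ once and g = 1 + x g three times.
five-term-expansion : ∀ g₀ g y x → g₀ ≋ one ⊕ y ⊛ g₀ → g ≋ one ⊕ x ⊛ g → ∀ P N →
  (g₀ ⊛ (g ⊛ P)) N ≡ (g₀ ⊛ P) N ℤ.+ (x ⊛ P) N ℤ.+ (x ⊛ (y ⊛ (g₀ ⊛ (g ⊛ P)))) N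
                     ℤ.+ (x ⊛ (x ⊛ P)) N ℤ.+ (x ⊛ (x ⊛ (x ⊛ (g ⊛ P)))) N
five-term-expansion g₀ g y x g₀-unfold g-unfold P N = begin
  (g₀ ⊛ (g ⊛ P)) N                                        ≡⟨ solve 3 (λ g₀ g P → g₀ ⊙ (g ⊙ P) ⊜ g ⊙ (g₀ ⊙ P)) ≋-refl g₀ g P N ⟩
  (g ⊛ (g₀ ⊛ P)) N                                        ≡⟨ geometric-⊛-unfold g x g-unfold (g₀ ⊛ P) N ⟩
  (g₀ ⊛ P) N ℤ.+ (x ⊛ (g ⊛ (g₀ ⊛ P))) N                    ≡⟨ cong (λ t → (g₀ ⊛ P) N ℤ.+ t) (x-tail N) ⟩
  (g₀ ⊛ P) N ℤ.+ ((x ⊛ P) N ℤ.+ ((x ⊛ (x ⊛ P)) N ℤ.+ T₇) ℤ.+ T₅)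
    ≡⟨ regroup ((g₀ ⊛ P) N) ((x ⊛ P) N) ((x ⊛ (x ⊛ P)) N) T₇ T₅ ⟩
  (g₀ ⊛ P) N ℤ.+ (x ⊛ P) N ℤ.+ T₅ ℤ.+ (x ⊛ (x ⊛ P)) N ℤ.+ T₇ ∎
  where
  T₅ = (x ⊛ (y ⊛ (g₀ ⊛ (g ⊛ P)))) N
  T₇ = (x ⊛ (x ⊛ (x ⊛ (g ⊛ P)))) N
  x-unfold : ∀ h z → h ≋ one ⊕ z ⊛ h → ∀ X → x ⊛ (h ⊛ X) ≋ x ⊛ X ⊕ x ⊛ (z ⊛ (h ⊛ X))
  x-unfold h z h-unfold X = ≋-trans (⊛-congʳ x (geometric-⊛-unfold h z h-unfold X)) (⊛-distribˡ x X (z ⊛ (h ⊛ X)))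
  x-tail : x ⊛ (g ⊛ (g₀ ⊛ P)) ≋ (x ⊛ P ⊕ (x ⊛ (x ⊛ P) ⊕ x ⊛ (x ⊛ (x ⊛ (g ⊛ P))))) ⊕ x ⊛ (y ⊛ (g₀ ⊛ (g ⊛ P)))
  x-tail =
    ≋-trans (⊛-congʳ x (solve 3 (λ g₀ g P → g ⊙ (g₀ ⊙ P) ⊜ g₀ ⊙ (g ⊙ P)) ≋-refl g₀ g P))
    (≋-trans (x-unfold g₀ y g₀-unfold (g ⊛ P))
    (⊕-cong (≋-trans (x-unfold g x g-unfold P) (⊕-congʳ (x ⊛ P)
              (≋-trans (⊛-congʳ x (x-unfold g x g-unfold P)) (⊛-distribˡ x (x ⊛ P) (x ⊛ (x ⊛ (g ⊛ P)))))))
            ≋-refl))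
  regroup : ∀ a b c d e → a ℤ.+ ((b ℤ.+ (c ℤ.+ d)) ℤ.+ e) ≡ a ℤ.+ b ℤ.+ e ℤ.+ c ℤ.+ d
  regroup = ℤ-solve-∀

rhs₂ : ℕ → PS
rhs₂ m = mono (3 ℕ.* m ℕ.+ 4) ⊛ invPoch 2 (m ∸ 1)

rhs₃ rhs₄ rhs₅ rhs₆ rhs₇ : ℕ → ℕ → PS
rhs₃ m k = mono (k ℕ.* (k ℕ.+ m) ℕ.+ 2 ℕ.* k ℕ.+ m) ⊛ invPoch 1 k ⊛ invPoch 2 (k ℕ.+ m ∸ 2)
rhs₄ m k = mono (k ℕ.* (k ℕ.+ m) ℕ.+ 3 ℕ.* k ℕ.+ 2 ℕ.* m) ⊛ invPoch 2 (k ∸ 1) ⊛ invPoch 2 (k ℕ.+ m ∸ 2)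
rhs₅ m k = mono (k ℕ.* (k ℕ.+ m) ℕ.+ 3 ℕ.* k ℕ.+ 2 ℕ.* m ℕ.+ 1) ⊛ invPoch 1 k ⊛ invPoch 2 (k ℕ.+ m ∸ 1)
rhs₆ m k = mono (k ℕ.* (k ℕ.+ m) ℕ.+ 4 ℕ.* k ℕ.+ 3 ℕ.* m) ⊛ invPoch 2 (k ∸ 1) ⊛ invPoch 2 (k ℕ.+ m ∸ 2)
rhs₇ m k = mono (k ℕ.* (k ℕ.+ m) ℕ.+ 5 ℕ.* k ℕ.+ 4 ℕ.* m) ⊛ invPoch 2 (k ∸ 1) ⊛ invPoch 2 (k ℕ.+ m ∸ 1)

rhs₄-one : ∀ m′ → rhs₄ (suc m′) 1 ≋ rhs₂ (suc m′)
rhs₄-one m′ = ≋-trans (⊛-congˡ (invPoch 2 m′) (≋-trans (⊛-identityʳ _) (≡⇒≋ (cong mono (exponent m′))))) ≋-refl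
  where
  exponent : ∀ m′ → 1 ℕ.* (1 ℕ.+ suc m′) ℕ.+ 3 ℕ.* 1 ℕ.+ 2 ℕ.* suc m′ ≡ 3 ℕ.* suc m′ ℕ.+ 4
  exponent = ℕ-solve-∀

invPoch-one-suc : ∀ n → invPoch 1 (suc n) ≋ geomInv 0 ⊛ invPoch 2 n
invPoch-one-suc zero    = ≋-trans (⊛-identityˡ (geomInv 0)) (≋-sym (⊛-identityʳ (geomInv 0)))
invPoch-one-suc (suc n) = ≋-trans (⊛-congˡ (geomInv (suc n)) (invPoch-one-suc n)) (⊛-assoc (geomInv 0) (invPoch 2 n) (geomInv (suc n)))

invPoch-≡ : ∀ s {a b} → a ≡ b → invPoch s a ≋ invPoch s b
invPoch-≡ s refl = ≋-refl

mono-split : ∀ {e} a b → e ≡ a ℕ.+ b → mono e ≋ mono a ⊛ mono b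
mono-split a b refl = ≋-sym (mono-+ a b)

-- With k = j + 1, m = m′ + 1, L = k + m and P = q^(k(k+m)+2k+m) / ((q²;q)_(k-1) (q²;q)_(k+m-2)),
-- each summand for this k is P times a monomial in q, q^L, 1/(1-q) and 1/(1-q^L).
module _ (j m′ : ℕ) where
  private
    k m L : ℕ
    k = suc j
    m = suc m′
    L = suc (suc (j ℕ.+ m′))
    E : ℕ
    E = k ℕ.* (k ℕ.+ m) ℕ.+ 2 ℕ.* k ℕ.+ m
    g₀ g x a b P : PS
    g₀ = geomInv 0
    g = geomInv (suc (j ℕ.+ m′))
    x = mono L
    a = invPoch 2 j
    b = invPoch 2 (j ℕ.+ m′)
    P = mono E ⊛ (a ⊛ b)

    k+m∸2 : k ℕ.+ m ∸ 2 ≡ j ℕ.+ m′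
    k+m∸2 = cong (_∸ 1) (ℕₚ.+-suc j m′)
    k+m∸1 : k ℕ.+ m ∸ 1 ≡ suc (j ℕ.+ m′)
    k+m∸1 = ℕₚ.+-suc j m′


  crankOnesGF-normal : crankOnesGF m k ≋ g₀ ⊛ (g ⊛ P)
  crankOnesGF-normal =
    ≋-trans (solve 5 (λ mk a mB mC I → (mk ⊙ a) ⊙ (mB ⊙ (mC ⊙ I)) ⊜ (mk ⊙ (mB ⊙ mC)) ⊙ (a ⊙ I)) ≋-refl
               (mono k) a (mono (k ℕ.* (m ℕ.+ k))) (mono (m ℕ.+ k)) (invPoch 1 (m ℕ.+ k)))
    (≋-trans (⊛-cong (≋-sym (≋-trans (mono-split k _ (exponent j m′)) (⊛-congʳ (mono k) (mono-split (k ℕ.* (m ℕ.+ k)) (m ℕ.+ k) refl))))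
                     (⊛-congʳ a (≋-trans (invPoch-one-suc (m′ ℕ.+ suc j)) (⊛-congʳ g₀ (invPoch-≡ 2 m′+k≡)))))
    (solve 5 (λ mE a g₀ b g → mE ⊙ (a ⊙ (g₀ ⊙ (b ⊙ g))) ⊜ g₀ ⊙ (g ⊙ (mE ⊙ (a ⊙ b)))) ≋-refl (mono E) a g₀ b g))
    where
    exponent : ∀ j m′ → suc j ℕ.* (suc j ℕ.+ suc m′) ℕ.+ 2 ℕ.* suc j ℕ.+ suc m′
                        ≡ suc j ℕ.+ (suc j ℕ.* (suc m′ ℕ.+ suc j) ℕ.+ (suc m′ ℕ.+ suc j))
    exponent = ℕ-solve-∀
    m′+k≡ : m′ ℕ.+ suc j ≡ suc (j ℕ.+ m′)
    m′+k≡ = ℕₚ.+-suc m′ j ⟨ trans ⟩ cong suc (ℕₚ.+-comm m′ j)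

  rhs₃-normal : rhs₃ m k ≋ g₀ ⊛ P
  rhs₃-normal =
    ≋-trans (⊛-cong (⊛-congʳ (mono E) (invPoch-one-suc j)) (invPoch-≡ 2 k+m∸2))
    (solve 4 (λ mE g₀ a b → (mE ⊙ (g₀ ⊙ a)) ⊙ b ⊜ g₀ ⊙ (mE ⊙ (a ⊙ b))) ≋-refl (mono E) g₀ a b)

  rhs₄-normal : rhs₄ m k ≋ x ⊛ P
  rhs₄-normal =
    ≋-trans (⊛-cong (⊛-congˡ a (mono-split L E (exponent j m′))) (invPoch-≡ 2 k+m∸2))
    (solve 4 (λ x mE a b → ((x ⊙ mE) ⊙ a) ⊙ b ⊜ x ⊙ (mE ⊙ (a ⊙ b))) ≋-refl x (mono E) a b)
    where
    exponent : ∀ j m′ → suc j ℕ.* (suc j ℕ.+ suc m′) ℕ.+ 3 ℕ.* suc j ℕ.+ 2 ℕ.* suc m′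
                        ≡ suc (suc (j ℕ.+ m′)) ℕ.+ (suc j ℕ.* (suc j ℕ.+ suc m′) ℕ.+ 2 ℕ.* suc j ℕ.+ suc m′)
    exponent = ℕ-solve-∀

  rhs₅-normal : rhs₅ m k ≋ x ⊛ (mono 1 ⊛ (g₀ ⊛ (g ⊛ P)))
  rhs₅-normal =
    ≋-trans (⊛-cong (⊛-congʳ (mono E₅) (invPoch-one-suc j)) (invPoch-≡ 2 k+m∸1))
    (≋-trans (solve 5 (λ mE₅ g₀ a b g → (mE₅ ⊙ (g₀ ⊙ a)) ⊙ (b ⊙ g) ⊜ mE₅ ⊙ (g₀ ⊙ (g ⊙ (a ⊙ b)))) ≋-refl (mono E₅) g₀ a b g)
    (≋-trans (⊛-congˡ (g₀ ⊛ (g ⊛ (a ⊛ b))) (≋-trans (mono-split L (1 ℕ.+ E) (exponent j m′)) (⊛-congʳ x (mono-split 1 E refl))))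
    (solve 6 (λ x q mE g₀ g ab → (x ⊙ (q ⊙ mE)) ⊙ (g₀ ⊙ (g ⊙ ab)) ⊜ x ⊙ (q ⊙ (g₀ ⊙ (g ⊙ (mE ⊙ ab))))) ≋-refl
       x (mono 1) (mono E) g₀ g (a ⊛ b))))
    where
    E₅ = k ℕ.* (k ℕ.+ m) ℕ.+ 3 ℕ.* k ℕ.+ 2 ℕ.* m ℕ.+ 1
    exponent : ∀ j m′ → suc j ℕ.* (suc j ℕ.+ suc m′) ℕ.+ 3 ℕ.* suc j ℕ.+ 2 ℕ.* suc m′ ℕ.+ 1
                        ≡ suc (suc (j ℕ.+ m′)) ℕ.+ (1 ℕ.+ (suc j ℕ.* (suc j ℕ.+ suc m′) ℕ.+ 2 ℕ.* suc j ℕ.+ suc m′))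
    exponent = ℕ-solve-∀

  rhs₆-normal : rhs₆ m k ≋ x ⊛ (x ⊛ P)
  rhs₆-normal =
    ≋-trans (⊛-cong (⊛-congˡ a (≋-trans (mono-split L (L ℕ.+ E) (exponent j m′)) (⊛-congʳ x (mono-split L E refl))))
                    (invPoch-≡ 2 k+m∸2))
    (solve 4 (λ x mE a b → ((x ⊙ (x ⊙ mE)) ⊙ a) ⊙ b ⊜ x ⊙ (x ⊙ (mE ⊙ (a ⊙ b)))) ≋-refl x (mono E) a b)
    where
    exponent : ∀ j m′ → suc j ℕ.* (suc j ℕ.+ suc m′) ℕ.+ 4 ℕ.* suc j ℕ.+ 3 ℕ.* suc m′
                        ≡ suc (suc (j ℕ.+ m′)) ℕ.+ (suc (suc (j ℕ.+ m′)) ℕ.+ (suc j ℕ.* (suc j ℕ.+ suc m′) ℕ.+ 2 ℕ.* suc j ℕ.+ suc m′))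
    exponent = ℕ-solve-∀

  rhs₇-normal : rhs₇ m k ≋ x ⊛ (x ⊛ (x ⊛ (g ⊛ P)))
  rhs₇-normal =
    ≋-trans (⊛-cong (⊛-congˡ a (≋-trans (mono-split L (L ℕ.+ (L ℕ.+ E)) (exponent j m′))
                                        (⊛-congʳ x (≋-trans (mono-split L (L ℕ.+ E) refl) (⊛-congʳ x (mono-split L E refl))))))
                    (invPoch-≡ 2 k+m∸1))
    (solve 5 (λ x mE a b g → ((x ⊙ (x ⊙ (x ⊙ mE))) ⊙ a) ⊙ (b ⊙ g) ⊜ x ⊙ (x ⊙ (x ⊙ (g ⊙ (mE ⊙ (a ⊙ b)))))) ≋-refl x (mono E) a b g)
    where
    exponent : ∀ j m′ → suc j ℕ.* (suc j ℕ.+ suc m′) ℕ.+ 5 ℕ.* suc j ℕ.+ 4 ℕ.* suc m′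
                        ≡ suc (suc (j ℕ.+ m′)) ℕ.+ (suc (suc (j ℕ.+ m′)) ℕ.+ (suc (suc (j ℕ.+ m′)) ℕ.+ (suc j ℕ.* (suc j ℕ.+ suc m′) ℕ.+ 2 ℕ.* suc j ℕ.+ suc m′)))
    exponent = ℕ-solve-∀

  crankOnesGF-expansion : ∀ N → crankOnesGF m k N ≡ rhs₃ m k N ℤ.+ rhs₄ m k N ℤ.+ rhs₅ m k N ℤ.+ rhs₆ m k N ℤ.+ rhs₇ m k N
  crankOnesGF-expansion N =
    crankOnesGF-normal N
    ⟨ trans ⟩ five-term-expansion g₀ g (mono 1) x (geomInv-unfold 0) (geomInv-unfold (suc (j ℕ.+ m′))) P N
    ⟨ trans ⟩ sym (cong₂ ℤ._+_ (cong₂ ℤ._+_ (cong₂ ℤ._+_ (cong₂ ℤ._+_ (rhs₃-normal N) (rhs₄-normal N))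
                                                        (rhs₅-normal N)) (rhs₆-normal N)) (rhs₇-normal N))

  private
    P-order : ∀ f N → N ≤ suc j → (f ⊛ P) N ≡ 0ℤ
    P-order f N N≤k =
      solve 3 (λ f mE h → f ⊙ (mE ⊙ h) ⊜ mE ⊙ (f ⊙ h)) ≋-refl f (mono E) (a ⊛ b) N
      ⟨ trans ⟩ mono-⊛-coeff-< E N (f ⊛ (a ⊛ b)) N<E
      where
      N<E : N < E
      N<E = ℕₚ.≤-trans (s≤s N≤k) (ℕₚ.≤-trans 1+k≤2k (ℕₚ.≤-trans (ℕₚ.m≤n+m (2 ℕ.* k) (k ℕ.* (k ℕ.+ m))) (ℕₚ.m≤m+n _ m)))
        where
        1+k≤2k : suc k ≤ 2 ℕ.* k
        1+k≤2k = ℕₚ.≤-trans (s≤s (ℕₚ.m≤n+m k j)) (ℕₚ.≤-reflexive (cong (k ℕ.+_) (sym (ℕₚ.+-identityʳ k))))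

  crankOnesGF-vanishes : ∀ N → N ≤ suc j → crankOnesGF m k N ≡ 0ℤ
  crankOnesGF-vanishes N N≤k = crankOnesGF-normal N ⟨ trans ⟩ sym (⊛-assoc g₀ g P N) ⟨ trans ⟩ P-order (g₀ ⊛ g) N N≤k

  rhs₄-vanishes : ∀ N → N ≤ suc j → rhs₄ m k N ≡ 0ℤ
  rhs₄-vanishes N N≤k = rhs₄-normal N ⟨ trans ⟩ P-order x N N≤k

crankOnesGF-sum : ℕ → ℕ → ℤ
crankOnesGF-sum m N = Σ< (suc N) (λ j → crankOnesGF m (suc j) N)

rhs-expansion : ∀ m′ N → rhs (suc m′) N ≡ qPoch₂GF (suc m′) N ℤ.+ crankOnesGF-sum (suc m′) N
rhs-expansion m′ N = sym (begin
  qPoch₂GF m N ℤ.+ crankOnesGF-sum m N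
    ≡⟨ cong (λ t → qPoch₂GF m N ℤ.+ t) (Σ<-cong (suc N) (λ j _ → crankOnesGF-expansion j m′ N)) ⟩
  qPoch₂GF m N ℤ.+ Σ< (suc N) (λ j → rhs₃ m (suc j) N ℤ.+ rhs₄ m (suc j) N ℤ.+ rhs₅ m (suc j) N ℤ.+ rhs₆ m (suc j) N ℤ.+ rhs₇ m (suc j) N)
    ≡⟨ cong (λ t → qPoch₂GF m N ℤ.+ t) (Σ<-+ (suc N) _ _ ⟨ trans ⟩ cong (ℤ._+ S₇) (Σ<-+ (suc N) _ _ ⟨ trans ⟩ cong (ℤ._+ S₆)
                                          (Σ<-+ (suc N) _ _ ⟨ trans ⟩ cong (ℤ._+ S₅) (Σ<-+ (suc N) _ _)))) ⟩
  qPoch₂GF m N ℤ.+ (S₃ ℤ.+ Σ< (suc N) (λ j → rhs₄ m (suc j) N) ℤ.+ S₅ ℤ.+ S₆ ℤ.+ S₇)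
    ≡⟨ cong (λ t → qPoch₂GF m N ℤ.+ (S₃ ℤ.+ t ℤ.+ S₅ ℤ.+ S₆ ℤ.+ S₇)) (Σ<-head N (λ j → rhs₄ m (suc j) N)) ⟩
  qPoch₂GF m N ℤ.+ (S₃ ℤ.+ (rhs₄ m 1 N ℤ.+ S₄′) ℤ.+ S₅ ℤ.+ S₆ ℤ.+ S₇)
    ≡⟨ cong (λ t → qPoch₂GF m N ℤ.+ (S₃ ℤ.+ (t ℤ.+ S₄′) ℤ.+ S₅ ℤ.+ S₆ ℤ.+ S₇)) (rhs₄-one m′ N) ⟩
  qPoch₂GF m N ℤ.+ (S₃ ℤ.+ (rhs₂ m N ℤ.+ S₄′) ℤ.+ S₅ ℤ.+ S₆ ℤ.+ S₇)
    ≡⟨ regroup (qPoch₂GF m N) (rhs₂ m N) S₃ S₄′ S₅ S₆ S₇ ⟩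
  qPoch₂GF m N ℤ.+ rhs₂ m N ℤ.+ S₃ ℤ.+ (S₄′ ℤ.+ 0ℤ) ℤ.+ S₅ ℤ.+ S₆ ℤ.+ S₇
    ≡⟨ cong (λ t → qPoch₂GF m N ℤ.+ rhs₂ m N ℤ.+ S₃ ℤ.+ (S₄′ ℤ.+ t) ℤ.+ S₅ ℤ.+ S₆ ℤ.+ S₇) (rhs₄-vanishes (suc N) m′ N (ℕₚ.m≤n⇒m≤1+n (ℕₚ.n≤1+n N))) ⟨
  rhs m N ∎)
  where
  m = suc m′
  S₃ = sumFrom 1 (rhs₃ m) N
  S₄′ = Σ< N (λ j → rhs₄ m (2 ℕ.+ j) N)
  S₅ = sumFrom 1 (rhs₅ m) N
  S₆ = sumFrom 1 (rhs₆ m) N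
  S₇ = sumFrom 1 (rhs₇ m) N
  regroup : ∀ a b c d e f g → a ℤ.+ (c ℤ.+ (b ℤ.+ d) ℤ.+ e ℤ.+ f ℤ.+ g) ≡ a ℤ.+ b ℤ.+ c ℤ.+ (d ℤ.+ 0ℤ) ℤ.+ e ℤ.+ f ℤ.+ g
  regroup = ℤ-solve-∀

crankGF-expansion : ∀ m′ N → crankGF (suc m′) N ≡ qPoch₂GF (suc m′) N ℤ.+ crankOnesGF-sum (suc m′) N
crankGF-expansion m′ zero = sym (cong₂ ℤ._+_ (mono-⊛-coeff-< (suc m′) 0 (invPoch 2 m′) (s≤s z≤n)) (crankOnesGF-vanishes 0 m′ 0 z≤n))
crankGF-expansion m′ (suc zero) =
  one-part m′ ⟨ trans ⟩ cong (λ t → qPoch₂GF (suc m′) 1 ℤ.+ t) (sym (cong₂ ℤ._+_ (cong (λ t → 0ℤ ℤ.+ t) (crankOnesGF-vanishes 0 m′ 1 ℕₚ.≤-refl))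
                                                                                    (crankOnesGF-vanishes 1 m′ 1 (ℕₚ.n≤1+n 1))))
  where
  -- the convention M(1, 1) = 1 matches the coefficient of q in q / (q²;q)₀
  one-part : ∀ m′ → crankGF (suc m′) 1 ≡ qPoch₂GF (suc m′) 1 ℤ.+ 0ℤ
  one-part zero     = refl
  one-part (suc m″) = sym (cong (ℤ._+ 0ℤ) (mono-⊛-coeff-< (2 ℕ.+ m″) 1 (invPoch 2 (suc m″)) (s≤s (s≤s z≤n))))
crankGF-expansion m′ (suc (suc n)) = begin
  crankGF m N
    ≡⟨ crankGF-split m n ⟩
  partitionGF (noOnesMax m) N N ℤ.+ Σ< N (λ w → partitionGF (onesAbove (suc w) (m ℕ.+ suc w)) N N)
    ≡⟨ cong₂ ℤ._+_ (noOnesMax-coeff m n (s≤s z≤n)) (Σ<-cong N (λ w w<N → onesAbove-coeff m w N w<N (s≤s z≤n))) ⟩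
  qPoch₂GF m N ℤ.+ Σ< N (λ w → crankOnesGF m (suc w) N)
    ≡⟨ cong (λ t → qPoch₂GF m N ℤ.+ t) (Σ<-extend (λ w → crankOnesGF m (suc w) N) (ℕₚ.n≤1+n N) beyond) ⟨
  qPoch₂GF m N ℤ.+ crankOnesGF-sum m N ∎
  where
  m = suc m′
  N = 2 ℕ.+ n
  beyond : ∀ w → N ≤ w → crankOnesGF m (suc w) N ≡ 0ℤ
  beyond w N≤w = crankOnesGF-vanishes w m′ N (ℕₚ.m≤n⇒m≤1+n N≤w)

lemma5p1 : (m : ℕ) → 1 ≤ m → crankGF m ≋ rhs m
lemma5p1 (suc m′) _ N = crankGF-expansion m′ N ⟨ trans ⟩ sym (rhs-expansion m′ N)
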